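{- Let $n$ be a positive integer. Then \[ \sum_{\beta \in B_{2n}}(-1)^{\ell_B(\beta)}q^{\operatorname{fmaj}(\beta)} =\prod_{i=1}^n(1-q^{4i-2})\sum_{\beta \in B_n}q^{2\operatorname{fmaj}(\beta)} .\]
   Context: $B_m$ is the group of bijections $\beta$ of $[-m,m]\setminus\{0\}$ with $\beta(-i)=-\beta(i)$, written in window notation $\beta=[\beta_1,\dots,\beta_m]$ with $\beta_i=\beta(i)$. For $\beta\in B_m$: $\operatorname{inv}(\beta)=|\{(i,j): 1\le i<j\le m,\ \beta_i>\beta_j\}|$ (usual order on integers); $\operatorname{N}_1(\beta)=|\{i:\beta_i<0\}|$; $\operatorname{N}_2(\beta)=|\{\{i,j\}: i\neq j,\ \beta_i+\beta_j<0\}|$; the Coxeter length is $\ell_B(\beta)=\operatorname{inv}(\beta)+\operatorname{N}_1(\beta)+\operatorname{N}_2(\beta)$. The descent set $\operatorname{Des}(\beta)$ is the set of $i\in[m-1]$ with $\beta_i\succ\beta_{i+1}$, where $\prec$ is the total order $-1\prec-2\prec\cdots\prec-m\prec 1\prec 2\prec\cdots\prec m$; $\operatorname{maj}(\beta)=\sum_{i\in\operatorname{Des}(\beta)}i$ and $\operatorname{fmaj}(\beta)=2\operatorname{maj}(\beta)+\operatorname{N}_1(\beta)$. -}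

module Defs where

open import Level using (Level)
open import Data.Bool using (Bool; T?; true; false; if_then_else_; _∧_; _∨_)
open import Data.Nat as ℕ using (ℕ; zero; suc)
import Data.Nat.Properties as ℕP
open import Data.Integer as ℤ using (ℤ; +_; -[1+_]; ∣_∣)
import Data.Integer.Properties as ℤP
open import Data.List using (List; []; _∷_; map; concatMap; filter; length; upTo; _++_; foldr)
open import Data.List.Relation.Unary.AllPairs using (AllPairs; allPairs?)
open import Relation.Nullary using (¬_; ¬?; does)
open import Relation.Binary.PropositionalEquality using (_≢_)
open import Algebra.Bundles using (CommutativeRing)

-- Signed permutations in window notation: lists [β₁,…,βₘ] of integers.

alphabet : ℕ → List ℤ
alphabet m = map (λ i → -[1+ i ]) (upTo m) ++ map (λ i → + suc i) (upTo m)

words : ℕ → List ℤ → List (List ℤ)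
words zero    A = [] ∷ []
words (suc k) A = concatMap (λ x → map (x ∷_) (words k A)) A

-- A window with entries in [-m,m]\{0} encodes an element of B_m iff the
-- absolute values of its entries are pairwise distinct.
DistinctAbs : List ℤ → Set
DistinctAbs = AllPairs (λ a b → ∣ a ∣ ≢ ∣ b ∣)

B : ℕ → List (List ℤ)
B m = filter (allPairs? (λ a b → ¬? (∣ a ∣ ℕP.≟ ∣ b ∣))) (words m (alphabet m))

count : {A : Set} → (A → Bool) → List A → ℕ
count p xs = length (filter (λ x → T? (p x)) xs)

ltℤ : ℤ → ℤ → Bool
ltℤ a b = does (a ℤ.<? b)

inv : List ℤ → ℕ
inv []       = 0
inv (x ∷ xs) = count (λ y → ltℤ y x) xs ℕ.+ inv xs

N₁ : List ℤ → ℕ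
N₁ w = count (λ y → ltℤ y (+ 0)) w

N₂ : List ℤ → ℕ
N₂ []       = 0
N₂ (x ∷ xs) = count (λ y → ltℤ (x ℤ.+ y) (+ 0)) xs ℕ.+ N₂ xs

ℓB : List ℤ → ℕ
ℓB w = inv w ℕ.+ N₁ w ℕ.+ N₂ w

-- The total order -1 ≺ -2 ≺ ⋯ ≺ -m ≺ 1 ≺ 2 ≺ ⋯ ≺ m:
-- a ≺ b iff (a<0 and b>0), or a,b of the same sign and |a| < |b|.
isNeg : ℤ → Bool
isNeg a = ltℤ a (+ 0)

precB : ℤ → ℤ → Bool
precB a b with isNeg a | isNeg b
... | true  | false = true
... | false | true  = false
... | _     | _     = does (∣ a ∣ ℕ.<? ∣ b ∣)

majFrom : ℕ → List ℤ → ℕ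
majFrom i []           = 0
majFrom i (x ∷ [])     = 0
majFrom i (x ∷ y ∷ r)  = (if precB y x then i else 0) ℕ.+ majFrom (suc i) (y ∷ r)

maj : List ℤ → ℕ
maj = majFrom 1

fmaj : List ℤ → ℕ
fmaj w = 2 ℕ.* maj w ℕ.+ N₁ w

module RingOps {c ℓ : Level} (R : CommutativeRing c ℓ) where
  open CommutativeRing R

  pow : Carrier → ℕ → Carrier
  pow x zero    = 1#
  pow x (suc k) = x * pow x k

  sumR : List Carrier → Carrier
  sumR = foldr _+_ 0#

  prodR : List Carrier → Carrier
  prodR = foldr _*_ 1#

  lhs : ℕ → Carrier → Carrier
  lhs n q = sumR (map (λ β → pow (- 1#) (ℓB β) * pow q (fmaj β)) (B (2 ℕ.* n)))

  rhs : ℕ → Carrier → Carrier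
  rhs n q = prodR (map (λ j → 1# - pow q (4 ℕ.* suc j ℕ.∸ 2)) (upTo n))
          * sumR (map (λ β → pow q (2 ℕ.* fmaj β)) (B n))

-- For σ² = 1 one has  Σ_{β ∈ B_m} σ^{ℓ_B(β)} q^{fmaj(β)} = ∏_{k=1}^{m} [2k]_{σ^k q},  where
-- [n]_x = 1 + x + ⋯ + x^{n-1} (geom x n below).  The left side of the theorem is the case σ = -1,
-- and the sum on the right is the case σ = 1 at q².  For σ = -1 the factors k = 2i-1 and k = 2i
-- combine to [4i-2]_{-q} [4i]_q = (1 - q^{4i-2}) [2i]_{q²}, since [2j]_y = (1 + y) [j]_{y²}
-- and (1 + y) [2k]_{-y} = 1 - y^{2k}.
--
-- The factorisation is proved by removing the last letter a of a window.  This changes ℓ_B by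
-- [a < 0] plus, modulo 2, the number of remaining letters of larger absolute value, and fmaj by
-- [a < 0] plus twice the length of the rest when a precedes its new last letter in ≺.  The
-- induction therefore runs over windows on an arbitrary set of absolute values, carrying extra
-- weights on absolute values and on the last letter; summing over the removed letter and over
-- the new last letter produces the factor [2k].

module Submission where

open import Defs
open import Level using (Level; _⊔_)
open import Function using (id; _∘_; Equivalence)
open import Data.Bool using (Bool; true; false; if_then_else_; _∧_; not; T?)
import Data.Bool.Properties as 𝔹
open import Data.Nat as ℕ using (ℕ; zero; suc; _<_; _<ᵇ_; _≡ᵇ_)
import Data.Nat.Properties as ℕP
open import Data.Nat.Solver using (module +-*-Solver)
open import Data.Integer as ℤ using (ℤ; -[1+_]; ∣_∣) renaming (+_ to pos)
open import Data.List using (List; []; _∷_; _∷ʳ_; _++_; map; concatMap; filter; length; upTo)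
import Data.List.Properties as List
open import Data.List.Relation.Unary.All as All using (All; []; _∷_)
open import Data.List.Relation.Unary.AllPairs using (AllPairs; allPairs?; []; _∷_)
import Data.List.Relation.Unary.AllPairs.Properties as AllPairs
open import Data.List.Relation.Unary.Any using (here; there)
open import Data.List.Membership.Propositional using (_∈_)
open import Data.Product using (∃; _×_; _,_)
open import Data.Sum using (_⊎_; inj₁; inj₂)
open import Relation.Nullary using (Dec; does; ¬?)
open import Relation.Unary using (Pred; Decidable)
import Relation.Binary.PropositionalEquality as ≡
open ≡ using (_≡_)
open import Algebra.Bundles using (CommutativeRing; CommutativeMonoid)
import Algebra.Properties.CommutativeSemigroup as CommutativeSemigroupProperties

module Combinatorics where
  open ≡ using (refl; sym; trans; cong; cong₂; module ≡-Reasoning)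
  open import Data.Nat using (_+_; _*_)
  open CommutativeSemigroupProperties ℕP.+-commutativeSemigroup using (interchange)
  private
    module ∧ = CommutativeSemigroupProperties (CommutativeMonoid.commutativeSemigroup 𝔹.∧-commutativeMonoid)

  bit : Bool → ℕ
  bit b = if b then 1 else 0

  count-∷ : {A : Set} (p : A → Bool) (x : A) (xs : List A) → count p (x ∷ xs) ≡ bit (p x) + count p xs
  count-∷ p x xs with p x
  ... | true  = refl
  ... | false = refl

  count-∷ʳ : {A : Set} (p : A → Bool) (xs : List A) (a : A) → count p (xs ∷ʳ a) ≡ count p xs + bit (p a)
  count-∷ʳ p xs a = begin
    length (filter (T? ∘ p) (xs ++ a ∷ []))          ≡⟨ cong length (List.filter-++ (T? ∘ p) xs (a ∷ [])) ⟩
    length (filter (T? ∘ p) xs ++ filter (T? ∘ p) (a ∷ [])) ≡⟨ List.length-++ (filter (T? ∘ p) xs) ⟩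
    count p xs + count p (a ∷ [])                     ≡⟨ cong (count p xs +_) (trans (count-∷ p a []) (ℕP.+-identityʳ _)) ⟩
    count p xs + bit (p a)                            ∎
    where open ≡-Reasoning

  count+count-∷ : {A : Set} (p p′ : A → Bool) (x : A) (xs : List A) →
    count p (x ∷ xs) + count p′ (x ∷ xs) ≡ (bit (p x) + bit (p′ x)) + (count p xs + count p′ xs)
  count+count-∷ p p′ x xs =
    trans (cong₂ _+_ (count-∷ p x xs) (count-∷ p′ x xs)) (interchange (bit (p x)) (count p xs) (bit (p′ x)) _)

  pairStat-∷ʳ : (r : ℤ → ℤ → Bool) (f : List ℤ → ℕ) → (∀ x xs → f (x ∷ xs) ≡ count (r x) xs + f xs) →
    (v : List ℤ) (a : ℤ) → f (v ∷ʳ a) ≡ f v + count (λ b → r b a) v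
  pairStat-∷ʳ r f unfold []       a = trans (unfold a []) (sym (ℕP.+-identityʳ (f [])))
  pairStat-∷ʳ r f unfold (x ∷ xs) a = begin
    f ((x ∷ xs) ∷ʳ a)                                                   ≡⟨ unfold x (xs ∷ʳ a) ⟩
    count (r x) (xs ∷ʳ a) + f (xs ∷ʳ a)                                  ≡⟨ cong₂ _+_ (count-∷ʳ (r x) xs a) (pairStat-∷ʳ r f unfold xs a) ⟩
    (count (r x) xs + bit (r x a)) + (f xs + count (λ b → r b a) xs)     ≡⟨ interchange (count (r x) xs) (bit (r x a)) (f xs) _ ⟩
    (count (r x) xs + f xs) + (bit (r x a) + count (λ b → r b a) xs)     ≡⟨ cong₂ _+_ (sym (unfold x xs)) (sym (count-∷ (λ b → r b a) x xs)) ⟩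
    f (x ∷ xs) + count (λ b → r b a) (x ∷ xs)                             ∎
    where open ≡-Reasoning

  ℓB-∷ʳ : (v : List ℤ) (a : ℤ) →
    ℓB (v ∷ʳ a) ≡ ℓB v + bit (isNeg a) + (count (ltℤ a) v + count (λ b → ltℤ (b ℤ.+ a) (pos 0)) v)
  ℓB-∷ʳ v a
    rewrite pairStat-∷ʳ (λ x y → ltℤ y x) inv (λ _ _ → refl) v a
          | count-∷ʳ isNeg v a
          | pairStat-∷ʳ (λ x y → ltℤ (x ℤ.+ y) (pos 0)) N₂ (λ _ _ → refl) v a
    = solve 6 (λ i c₁ n₁ n n₂ c₂ → (i :+ c₁) :+ (n₁ :+ n) :+ (n₂ :+ c₂) := i :+ n₁ :+ n₂ :+ n :+ (c₁ :+ c₂)) refl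
        (inv v) (count (ltℤ a) v) (N₁ v) (bit (isNeg a)) (N₂ v) (count (λ b → ltℤ (b ℤ.+ a) (pos 0)) v)
    where open +-*-Solver

  lastOr : ℤ → List ℤ → ℤ
  lastOr d []       = d
  lastOr d (x ∷ xs) = lastOr x xs

  lastOr-∷ʳ : (d : ℤ) (xs : List ℤ) (a : ℤ) → lastOr d (xs ∷ʳ a) ≡ a
  lastOr-∷ʳ d []       a = refl
  lastOr-∷ʳ d (x ∷ xs) a = lastOr-∷ʳ x xs a

  majFrom-∷ʳ : (i : ℕ) (y : ℤ) (r : List ℤ) (a : ℤ) →
    majFrom i ((y ∷ r) ∷ʳ a) ≡ majFrom i (y ∷ r) + (if precB a (lastOr y r) then i + length r else 0)
  majFrom-∷ʳ i y []      a with precB a y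
  ... | true  = refl
  ... | false = refl
  majFrom-∷ʳ i y (z ∷ r) a = begin
      d + majFrom (suc i) ((z ∷ r) ∷ʳ a)
    ≡⟨ cong (d +_) (majFrom-∷ʳ (suc i) z r a) ⟩
      d + (majFrom (suc i) (z ∷ r) + (if b then suc i + length r else 0))
    ≡⟨ sym (ℕP.+-assoc d _ _) ⟩
      d + majFrom (suc i) (z ∷ r) + (if b then suc i + length r else 0)
    ≡⟨ cong (λ k → d + majFrom (suc i) (z ∷ r) + (if b then k else 0)) (sym (ℕP.+-suc i (length r))) ⟩
      d + majFrom (suc i) (z ∷ r) + (if b then i + suc (length r) else 0)
    ∎
    where
      open ≡-Reasoning
      d = if precB z y then i else 0
      b = precB a (lastOr z r)

  fmaj-∷ʳ : (y : ℤ) (r : List ℤ) (a : ℤ) →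
    fmaj ((y ∷ r) ∷ʳ a) ≡ fmaj (y ∷ r) + bit (isNeg a) + 2 * (if precB a (lastOr y r) then suc (length r) else 0)
  fmaj-∷ʳ y r a rewrite majFrom-∷ʳ 1 y r a | count-∷ʳ isNeg (y ∷ r) a =
    solve 4 (λ m d n₁ n → con 2 :* (m :+ d) :+ (n₁ :+ n) := con 2 :* m :+ n₁ :+ n :+ con 2 :* d) refl
      (maj (y ∷ r)) (if precB a (lastOr y r) then suc (length r) else 0) (N₁ (y ∷ r)) (bit (isNeg a))
    where open +-*-Solver

  <ᵇ⇒∸-suc : (m n : ℕ) → (m <ᵇ n) ≡ true → ∃ λ k → n ℕ.∸ m ≡ suc k
  <ᵇ⇒∸-suc zero    (suc n) _  = n , refl
  <ᵇ⇒∸-suc (suc m) (suc n) lt = <ᵇ⇒∸-suc m n lt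

  ⊖-<0 : (m n : ℕ) → ltℤ (m ℤ.⊖ n) (pos 0) ≡ (m <ᵇ n)
  ⊖-<0 m n with m <ᵇ n in lt
  ... | false = refl
  ... | true with <ᵇ⇒∸-suc m n lt
  ...   | k , eq rewrite eq = refl

  <ᵇ-irrefl : (t : ℕ) → (t <ᵇ t) ≡ false
  <ᵇ-irrefl zero    = refl
  <ᵇ-irrefl (suc t) = <ᵇ-irrefl t

  ≡ᵇ-refl : (t : ℕ) → (t ≡ᵇ t) ≡ true
  ≡ᵇ-refl zero    = refl
  ≡ᵇ-refl (suc t) = ≡ᵇ-refl t

  <ᵇ⇒≢ᵇ : (a b : ℕ) → (a <ᵇ b) ≡ true → (a ≡ᵇ b) ≡ false
  <ᵇ⇒≢ᵇ zero    (suc b) _  = refl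
  <ᵇ⇒≢ᵇ (suc a) (suc b) lt = <ᵇ⇒≢ᵇ a b lt

  <ᵇ⇒≢ᵇ˘ : (a b : ℕ) → (a <ᵇ b) ≡ true → (b ≡ᵇ a) ≡ false
  <ᵇ⇒≢ᵇ˘ zero    (suc b) _  = refl
  <ᵇ⇒≢ᵇ˘ (suc a) (suc b) lt = <ᵇ⇒≢ᵇ˘ a b lt

  <ᵇ-trans : (a b c : ℕ) → (a <ᵇ b) ≡ true → (b <ᵇ c) ≡ true → (a <ᵇ c) ≡ true
  <ᵇ-trans zero    (suc b) (suc c) _  _  = refl
  <ᵇ-trans (suc a) (suc b) (suc c) p q = <ᵇ-trans a b c p q

  <ᵇ-asym : (a b : ℕ) → (a <ᵇ b) ≡ true → (b <ᵇ a) ≡ false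
  <ᵇ-asym zero    (suc b) _  = refl
  <ᵇ-asym (suc a) (suc b) lt = <ᵇ-asym a b lt

  <ᵇ-connex : (t i : ℕ) → (t ≡ᵇ i) ≡ false →
    ((i <ᵇ t) ≡ true × (t <ᵇ i) ≡ false) ⊎ ((i <ᵇ t) ≡ false × (t <ᵇ i) ≡ true)
  <ᵇ-connex zero    (suc i) _ = inj₂ (refl , refl)
  <ᵇ-connex (suc t) zero    _ = inj₁ (refl , refl)
  <ᵇ-connex (suc t) (suc i) h = <ᵇ-connex t i h

  pairSign-parity : (a b : ℤ) .⦃ _ : ℤ.NonZero a ⦄ → (∣ b ∣ ≡ᵇ ∣ a ∣) ≡ false →
    ∃ λ e → bit (ltℤ a b) + bit (ltℤ (b ℤ.+ a) (pos 0)) ≡ bit (∣ a ∣ <ᵇ ∣ b ∣) + 2 * e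
  pairSign-parity (pos (suc i)) (pos zero)    _ = 0 , refl
  pairSign-parity (pos (suc i)) (pos (suc t)) _ = 0 , refl
  pairSign-parity (pos (suc i)) -[1+ t ]      _ = 0 , trans (cong bit (⊖-<0 (suc i) (suc t))) (sym (ℕP.+-identityʳ _))
  pairSign-parity -[1+ i ] (pos zero)    _ = 1 , refl
  pairSign-parity -[1+ i ] (pos (suc t)) h rewrite ⊖-<0 (suc t) (suc i) with <ᵇ-connex t i h
  ... | inj₁ (i<t , t≮i) rewrite i<t | t≮i = 0 , refl
  ... | inj₂ (i≮t , t<i) rewrite i≮t | t<i = 1 , refl
  pairSign-parity -[1+ i ] -[1+ t ]      h with <ᵇ-connex t i h
  ... | inj₁ (i<t , t≮i) rewrite i<t | t≮i = 0 , refl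
  ... | inj₂ (i≮t , t<i) rewrite i≮t | t<i = 1 , refl

  distinct? : (w : List ℤ) → Dec (DistinctAbs w)
  distinct? = allPairs? (λ a b → ¬? (∣ a ∣ ℕP.≟ ∣ b ∣))

  avoids : ℕ → ℤ → Bool
  avoids n b = not (∣ b ∣ ≡ᵇ n)

  every : {A : Set} → (A → Bool) → List A → Bool
  every p []       = true
  every p (x ∷ xs) = p x ∧ every p xs

  does-all?≡every : {A : Set} {ℓ : Level} {P : Pred A ℓ} (P? : Decidable P) (xs : List A) →
    does (All.all? P? xs) ≡ every (does ∘ P?) xs
  does-all?≡every P? []       = refl
  does-all?≡every P? (x ∷ xs) = cong (does (P? x) ∧_) (does-all?≡every P? xs)

  every-∷ʳ : {A : Set} (p : A → Bool) (xs : List A) (a : A) → every p (xs ∷ʳ a) ≡ every p xs ∧ p a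
  every-∷ʳ p []       a = 𝔹.∧-comm (p a) true
  every-∷ʳ p (x ∷ xs) a = trans (cong (p x ∧_) (every-∷ʳ p xs a)) (sym (𝔹.∧-assoc (p x) (every p xs) (p a)))

  distinct-∷ʳ : (v : List ℤ) (a : ℤ) → does (distinct? (v ∷ʳ a)) ≡ every (avoids ∣ a ∣) v ∧ does (distinct? v)
  distinct-∷ʳ []       a = refl
  distinct-∷ʳ (x ∷ xs) a = begin
      does (All.all? x? (xs ∷ʳ a)) ∧ does (distinct? (xs ∷ʳ a))
    ≡⟨ cong₂ _∧_ (trans (does-all?≡every x? (xs ∷ʳ a)) (every-∷ʳ (does ∘ x?) xs a)) (distinct-∷ʳ xs a) ⟩
      (every (does ∘ x?) xs ∧ avoids ∣ a ∣ x) ∧ (every (avoids ∣ a ∣) xs ∧ does (distinct? xs))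
    ≡⟨ cong (_∧ _) (𝔹.∧-comm (every (does ∘ x?) xs) _) ⟩
      (avoids ∣ a ∣ x ∧ every (does ∘ x?) xs) ∧ (every (avoids ∣ a ∣) xs ∧ does (distinct? xs))
    ≡⟨ ∧.interchange (avoids ∣ a ∣ x) _ _ _ ⟩
      (avoids ∣ a ∣ x ∧ every (avoids ∣ a ∣) xs) ∧ (every (does ∘ x?) xs ∧ does (distinct? xs))
    ≡⟨ cong (λ b → every (avoids ∣ a ∣) (x ∷ xs) ∧ (b ∧ does (distinct? xs))) (sym (does-all?≡every x? xs)) ⟩
      every (avoids ∣ a ∣) (x ∷ xs) ∧ does (distinct? (x ∷ xs))
    ∎
    where
      open ≡-Reasoning
      x? = λ b → ¬? (∣ x ∣ ℕP.≟ ∣ b ∣)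

  letters : List ℕ → List ℤ
  letters T = map -[1+_] T ++ map (pos ∘ suc) T

  Sorted : List ℕ → Set
  Sorted = AllPairs (λ a b → (a <ᵇ b) ≡ true)

  remove : ℕ → List ℕ → List ℕ
  remove i = filter (λ t → T? (not (t ≡ᵇ i)))

  countAbove countBelow : ℕ → List ℕ → ℕ
  countAbove i = count (i <ᵇ_)
  countBelow i = count (_<ᵇ i)

  filter-map : {A B : Set} {ℓ : Level} {P : Pred B ℓ} (P? : Decidable P) (f : A → B) (xs : List A) →
    filter P? (map f xs) ≡ map f (filter (P? ∘ f) xs)
  filter-map P? f []       = refl
  filter-map P? f (x ∷ xs) with does (P? (f x))
  ... | true  = cong (f x ∷_) (filter-map P? f xs)
  ... | false = filter-map P? f xs

  filter-letters : (i : ℕ) (T : List ℕ) → filter (T? ∘ avoids (suc i)) (letters T) ≡ letters (remove i T)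
  filter-letters i T = trans (List.filter-++ (T? ∘ avoids (suc i)) (map -[1+_] T) _)
    (cong₂ _++_ (filter-map (T? ∘ avoids (suc i)) -[1+_] T) (filter-map (T? ∘ avoids (suc i)) (pos ∘ suc) T))

  <ᵇ-All-trans : {i s : ℕ} {S : List ℕ} → (i <ᵇ s) ≡ true →
    All (λ t → (s <ᵇ t) ≡ true) S → All (λ t → (i <ᵇ t) ≡ true) S
  <ᵇ-All-trans {i} {s} i<s = All.map (λ {t} → <ᵇ-trans i s t i<s)

  upTo-sorted : (n : ℕ) → Sorted (upTo n)
  upTo-sorted n = AllPairs.applyUpTo⁺₁ id n (λ i<j _ → Equivalence.to 𝔹.T-≡ (ℕP.<⇒<ᵇ i<j))

  remove-absent : (i : ℕ) (S : List ℕ) → All (λ t → (t ≡ᵇ i) ≡ false) S → remove i S ≡ S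
  remove-absent i []      []       = refl
  remove-absent i (s ∷ S) (s≢i ∷ h) rewrite s≢i = cong (s ∷_) (remove-absent i S h)

  remove-head : (s : ℕ) (S : List ℕ) → All (λ t → (s <ᵇ t) ≡ true) S → remove s (s ∷ S) ≡ S
  remove-head s S h rewrite ≡ᵇ-refl s = remove-absent s S (All.map (λ {t} → <ᵇ⇒≢ᵇ˘ s t) h)

  remove-sorted : (i : ℕ) (T : List ℕ) → Sorted T → Sorted (remove i T)
  remove-sorted i T = AllPairs.filter⁺ (λ t → T? (not (t ≡ᵇ i)))

  remove-excludes : (i : ℕ) (S : List ℕ) → All (λ t → (t ≡ᵇ i) ≡ false) (remove i S)
  remove-excludes i []      = []
  remove-excludes i (s ∷ S) with s ≡ᵇ i in s≟i
  ... | true  = remove-excludes i S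
  ... | false = s≟i ∷ remove-excludes i S

  length-remove : (i : ℕ) (T : List ℕ) → Sorted T → i ∈ T → length T ≡ suc (length (remove i T))
  length-remove i (s ∷ S) (h ∷ _)  (here refl) rewrite remove-head s S h = refl
  length-remove i (s ∷ S) (h ∷ st) (there i∈S) rewrite <ᵇ⇒≢ᵇ s i (All.lookup h i∈S) =
    cong suc (length-remove i S st i∈S)

  countAbove-remove : (i : ℕ) (S : List ℕ) → countAbove i (remove i S) ≡ countAbove i S
  countAbove-remove i []      = refl
  countAbove-remove i (s ∷ S) with s ≡ᵇ i in s≟i
  ... | true rewrite ℕP.≡ᵇ⇒≡ s i (Equivalence.from 𝔹.T-≡ s≟i) | <ᵇ-irrefl i = countAbove-remove i S
  ... | false = trans (count-∷ (i <ᵇ_) s (remove i S))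
                     (trans (cong (bit (i <ᵇ s) +_) (countAbove-remove i S)) (sym (count-∷ (i <ᵇ_) s S)))

  countBelow+countAbove : (i : ℕ) (S : List ℕ) → All (λ t → (t ≡ᵇ i) ≡ false) S →
    countBelow i S + countAbove i S ≡ length S
  countBelow+countAbove i []      []        = refl
  countBelow+countAbove i (s ∷ S) (s≢i ∷ h) with <ᵇ-connex s i s≢i
  ... | inj₁ (i<s , s≮i) rewrite count-∷ (_<ᵇ i) s S | count-∷ (i <ᵇ_) s S | i<s | s≮i =
    trans (ℕP.+-suc (countBelow i S) (countAbove i S)) (cong suc (countBelow+countAbove i S h))
  ... | inj₂ (i≮s , s<i) rewrite count-∷ (_<ᵇ i) s S | count-∷ (i <ᵇ_) s S | i≮s | s<i =
    cong suc (countBelow+countAbove i S h)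

  countAbove-all : (i : ℕ) (S : List ℕ) → All (λ t → (i <ᵇ t) ≡ true) S → countAbove i S ≡ length S
  countAbove-all i []      []        = refl
  countAbove-all i (s ∷ S) (i<s ∷ h) rewrite count-∷ (i <ᵇ_) s S | i<s = cong suc (countAbove-all i S h)

  countBelow-none : (i : ℕ) (S : List ℕ) → All (λ t → (i <ᵇ t) ≡ true) S → countBelow i S ≡ 0
  countBelow-none i []      []        = refl
  countBelow-none i (s ∷ S) (i<s ∷ h) rewrite count-∷ (_<ᵇ i) s S | <ᵇ-asym i s i<s = countBelow-none i S h

  countAbove-head : (s : ℕ) (S : List ℕ) → All (λ t → (s <ᵇ t) ≡ true) S → countAbove s (s ∷ S) ≡ length S
  countAbove-head s S h rewrite count-∷ (s <ᵇ_) s S | <ᵇ-irrefl s = countAbove-all s S h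

  countAbove-∷-below : (i s : ℕ) (S : List ℕ) → (s <ᵇ i) ≡ true → countAbove i (s ∷ S) ≡ countAbove i S
  countAbove-∷-below i s S s<i rewrite count-∷ (i <ᵇ_) s S | <ᵇ-asym s i s<i = refl

open Combinatorics

module _ {c ℓ : Level} (R : CommutativeRing c ℓ) where
  open CommutativeRing R hiding (zero)
  open RingOps R
  open import Relation.Binary.Reasoning.Setoid setoid
  open import Algebra.Solver.Ring.NaturalCoefficients.Default commutativeSemiring
  open CommutativeSemigroupProperties *-commutativeSemigroup using (x∙yz≈y∙xz)
  open import Algebra.Properties.Ring ring using (-‿distribˡ-*; -‿distribʳ-*; -‿involutive; -1*x≈-x)

  ∑ : {A : Set} → List A → (A → Carrier) → Carrier
  ∑ xs f = sumR (map f xs)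

  ∏ : {A : Set} → List A → (A → Carrier) → Carrier
  ∏ xs f = prodR (map f xs)

  when : Bool → Carrier → Carrier
  when b y = if b then y else 0#

  ∑-cong : {A : Set} (xs : List A) {f g : A → Carrier} → (∀ x → f x ≈ g x) → ∑ xs f ≈ ∑ xs g
  ∑-cong []       f≈g = refl
  ∑-cong (x ∷ xs) f≈g = +-cong (f≈g x) (∑-cong xs f≈g)

  ∑-cong-All : {A : Set} {P : A → Set} {xs : List A} {f g : A → Carrier} →
    All P xs → (∀ {x} → P x → f x ≈ g x) → ∑ xs f ≈ ∑ xs g
  ∑-cong-All []       f≈g = refl
  ∑-cong-All (p ∷ ps) f≈g = +-cong (f≈g p) (∑-cong-All ps f≈g)

  ∑-++ : {A : Set} (xs ys : List A) (f : A → Carrier) → ∑ (xs ++ ys) f ≈ ∑ xs f + ∑ ys f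
  ∑-++ []       ys f = sym (+-identityˡ _)
  ∑-++ (x ∷ xs) ys f = trans (+-congˡ (∑-++ xs ys f)) (sym (+-assoc _ _ _))

  ∏-++ : {A : Set} (xs ys : List A) (f : A → Carrier) → ∏ (xs ++ ys) f ≈ ∏ xs f * ∏ ys f
  ∏-++ []       ys f = sym (*-identityˡ _)
  ∏-++ (x ∷ xs) ys f = trans (*-congˡ (∏-++ xs ys f)) (sym (*-assoc _ _ _))

  ∑-map : {A B : Set} (xs : List A) (h : A → B) (f : B → Carrier) → ∑ (map h xs) f ≡ ∑ xs (λ x → f (h x))
  ∑-map []       h f = ≡.refl
  ∑-map (x ∷ xs) h f = ≡.cong (f (h x) +_) (∑-map xs h f)

  ∑-concatMap : {A B : Set} (xs : List A) (g : A → List B) (f : B → Carrier) →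
    ∑ (concatMap g xs) f ≈ ∑ xs (λ x → ∑ (g x) f)
  ∑-concatMap []       g f = refl
  ∑-concatMap (x ∷ xs) g f = trans (∑-++ (g x) (concatMap g xs) f) (+-congˡ (∑-concatMap xs g f))

  ∑-0 : {A : Set} (xs : List A) → ∑ xs (λ _ → 0#) ≈ 0#
  ∑-0 []       = refl
  ∑-0 (x ∷ xs) = trans (+-identityˡ _) (∑-0 xs)

  ∑-+ : {A : Set} (xs : List A) (f g : A → Carrier) → ∑ xs (λ x → f x + g x) ≈ ∑ xs f + ∑ xs g
  ∑-+ []       f g = sym (+-identityˡ _)
  ∑-+ (x ∷ xs) f g = trans (+-congˡ (∑-+ xs f g))
    (solve 4 (λ a b c d → (a :+ b) :+ (c :+ d) := (a :+ c) :+ (b :+ d)) refl (f x) (g x) (∑ xs f) (∑ xs g))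

  ∑-*ˡ : {A : Set} (xs : List A) (k : Carrier) (f : A → Carrier) → ∑ xs (λ x → k * f x) ≈ k * ∑ xs f
  ∑-*ˡ []       k f = sym (zeroʳ k)
  ∑-*ˡ (x ∷ xs) k f = trans (+-congˡ (∑-*ˡ xs k f)) (sym (distribˡ k _ _))

  ∑-comm : {A B : Set} (xs : List A) (ys : List B) (f : A → B → Carrier) →
    ∑ xs (λ x → ∑ ys (f x)) ≈ ∑ ys (λ y → ∑ xs (λ x → f x y))
  ∑-comm []       ys f = sym (∑-0 ys)
  ∑-comm (x ∷ xs) ys f = trans (+-congˡ (∑-comm xs ys f)) (sym (∑-+ ys (f x) (λ y → ∑ xs (λ x′ → f x′ y))))

  ∑-filter : {A : Set} {ℓ′ : Level} {P : Pred A ℓ′} (P? : Decidable P) (xs : List A) (f : A → Carrier) →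
    ∑ (filter P? xs) f ≈ ∑ xs (λ x → when (does (P? x)) (f x))
  ∑-filter P? []       f = refl
  ∑-filter P? (x ∷ xs) f with does (P? x)
  ... | true  = +-congˡ (∑-filter P? xs f)
  ... | false = trans (∑-filter P? xs f) (sym (+-identityˡ _))

  when-cong : (b : Bool) {x y : Carrier} → (b ≡ true → x ≈ y) → when b x ≈ when b y
  when-cong true  x≈y = x≈y ≡.refl
  when-cong false x≈y = refl

  when-*ʳ : (b : Bool) (k x : Carrier) → when b (k * x) ≈ k * when b x
  when-*ʳ true  k x = refl
  when-*ʳ false k x = sym (zeroʳ k)

  ∑-when : {A : Set} (b : Bool) (xs : List A) (f : A → Carrier) → ∑ xs (λ x → when b (f x)) ≈ when b (∑ xs f)
  ∑-when true  xs f = refl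
  ∑-when false xs f = ∑-0 xs

  ∏-* : {A : Set} (xs : List A) (f g : A → Carrier) → ∏ xs (λ x → f x * g x) ≈ ∏ xs f * ∏ xs g
  ∏-* []       f g = sym (*-identityˡ _)
  ∏-* (x ∷ xs) f g = trans (*-congˡ (∏-* xs f g))
    (solve 4 (λ a b c d → (a :* b) :* (c :* d) := (a :* c) :* (b :* d)) refl (f x) (g x) (∏ xs f) (∏ xs g))

  ∏-upTo-suc : (n : ℕ) (f : ℕ → Carrier) → ∏ (upTo (suc n)) f ≈ ∏ (upTo n) f * f n
  ∏-upTo-suc n f = begin
    ∏ (upTo (suc n)) f       ≡⟨ ≡.cong (λ xs → ∏ xs f) (List.applyUpTo-∷ʳ id n) ⟨
    ∏ (upTo n ∷ʳ n) f        ≈⟨ ∏-++ (upTo n) (n ∷ []) f ⟩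
    ∏ (upTo n) f * (f n * 1#) ≈⟨ *-congˡ (*-identityʳ (f n)) ⟩
    ∏ (upTo n) f * f n       ∎

  ∏-1 : {A : Set} (xs : List A) → ∏ xs (λ _ → 1#) ≈ 1#
  ∏-1 []       = refl
  ∏-1 (x ∷ xs) = trans (*-identityˡ _) (∏-1 xs)

  ∏-cong-every : {A : Set} (p : A → Bool) (xs : List A) {f g : A → Carrier} →
    every p xs ≡ true → (∀ x → p x ≡ true → f x ≈ g x) → ∏ xs f ≈ ∏ xs g
  ∏-cong-every p []       _  f≈g = refl
  ∏-cong-every p (x ∷ xs) ok f≈g with p x in px
  ∏-cong-every p (x ∷ xs) ok f≈g | true = *-cong (f≈g x px) (∏-cong-every p xs ok f≈g)

  pow-+ : (x : Carrier) (m n : ℕ) → pow x (m ℕ.+ n) ≈ pow x m * pow x n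
  pow-+ x zero    n = sym (*-identityˡ _)
  pow-+ x (suc m) n = trans (*-congˡ (pow-+ x m n)) (sym (*-assoc _ _ _))

  pow-*ˡ : (x y : Carrier) (n : ℕ) → pow (x * y) n ≈ pow x n * pow y n
  pow-*ˡ x y zero    = sym (*-identityˡ _)
  pow-*ˡ x y (suc n) = trans (*-congˡ (pow-*ˡ x y n))
    (solve 4 (λ a b c d → (a :* b) :* (c :* d) := (a :* c) :* (b :* d)) refl x y (pow x n) (pow y n))

  pow-pow : (x : Carrier) (k n : ℕ) → pow (pow x k) n ≈ pow x (k ℕ.* n)
  pow-pow x k zero    = reflexive (≡.cong (pow x) (≡.sym (ℕP.*-zeroʳ k)))
  pow-pow x k (suc n) = begin
    pow x k * pow (pow x k) n   ≈⟨ *-congˡ (pow-pow x k n) ⟩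
    pow x k * pow x (k ℕ.* n)   ≈⟨ pow-+ x k (k ℕ.* n) ⟨
    pow x (k ℕ.+ k ℕ.* n)       ≡⟨ ≡.cong (pow x) (ℕP.*-suc k n) ⟨
    pow x (k ℕ.* suc n)         ∎

  pow-cong : {x y : Carrier} (n : ℕ) → x ≈ y → pow x n ≈ pow y n
  pow-cong zero    x≈y = refl
  pow-cong (suc n) x≈y = *-cong x≈y (pow-cong n x≈y)

  pow-1# : (n : ℕ) → pow 1# n ≈ 1#
  pow-1# zero    = refl
  pow-1# (suc n) = trans (*-identityˡ _) (pow-1# n)

  pow-2* : (x : Carrier) (n : ℕ) → pow x (2 ℕ.* n) ≈ pow (x * x) n
  pow-2* x n = trans (sym (pow-pow x 2 n)) (pow-cong n (*-congˡ (*-identityʳ x)))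

  pow-double : (x : Carrier) (n : ℕ) → pow x (2 ℕ.* n) ≈ pow x n * pow x n
  pow-double x n = trans (pow-2* x n) (pow-*ˡ x x n)

  geom : Carrier → ℕ → Carrier
  geom y zero    = 0#
  geom y (suc n) = geom y n + pow y n

  geom-cong : {x y : Carrier} (n : ℕ) → x ≈ y → geom x n ≈ geom y n
  geom-cong zero    x≈y = refl
  geom-cong (suc n) x≈y = +-cong (geom-cong n x≈y) (pow-cong n x≈y)

  geom-+ : (y : Carrier) (a b : ℕ) → geom y (a ℕ.+ b) ≈ geom y a + pow y a * geom y b
  geom-+ y a zero    = begin
    geom y (a ℕ.+ 0)        ≡⟨ ≡.cong (geom y) (ℕP.+-identityʳ a) ⟩
    geom y a                ≈⟨ +-identityʳ _ ⟨
    geom y a + 0#           ≈⟨ +-congˡ (zeroʳ _) ⟨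
    geom y a + pow y a * 0# ∎
  geom-+ y a (suc b) = begin
      geom y (a ℕ.+ suc b)
    ≡⟨ ≡.cong (geom y) (ℕP.+-suc a b) ⟩
      geom y (a ℕ.+ b) + pow y (a ℕ.+ b)
    ≈⟨ +-cong (geom-+ y a b) (pow-+ y a b) ⟩
      (geom y a + pow y a * geom y b) + pow y a * pow y b
    ≈⟨ solve 4 (λ g p h q → (g :+ p :* h) :+ p :* q := g :+ p :* (h :+ q)) refl (geom y a) (pow y a) (geom y b) (pow y b) ⟩
      geom y a + pow y a * (geom y b + pow y b)
    ∎

  geom-2* : (y : Carrier) (n : ℕ) → geom y (2 ℕ.* n) ≈ geom y n + pow y n * geom y n
  geom-2* y n = trans (geom-+ y n (n ℕ.+ 0)) (+-congˡ (*-congˡ (reflexive (≡.cong (geom y) (ℕP.+-identityʳ n)))))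

  geom-2*-split : (y : Carrier) (j : ℕ) → geom y (2 ℕ.* j) ≈ (1# + y) * geom (y * y) j
  geom-2*-split y zero    = sym (zeroʳ _)
  geom-2*-split y (suc j) = begin
      geom y (2 ℕ.* suc j)
    ≡⟨ ≡.cong (geom y) (ℕP.*-suc 2 j) ⟩
      (geom y (2 ℕ.* j) + pow y (2 ℕ.* j)) + y * pow y (2 ℕ.* j)
    ≈⟨ +-cong (+-cong (geom-2*-split y j) (pow-2* y j)) (*-congˡ (pow-2* y j)) ⟩
      ((1# + y) * geom (y * y) j + pow (y * y) j) + y * pow (y * y) j
    ≈⟨ solve 3 (λ y g t → ((con 1 :+ y) :* g :+ t) :+ y :* t := (con 1 :+ y) :* (g :+ t)) refl y (geom (y * y) j) (pow (y * y) j) ⟩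
      (1# + y) * geom (y * y) (suc j)
    ∎

  pow-neg-2* : (y : Carrier) (k : ℕ) → pow (- y) (2 ℕ.* k) ≈ pow y (2 ℕ.* k)
  pow-neg-2* y k = begin
    pow (- y) (2 ℕ.* k)   ≈⟨ pow-2* (- y) k ⟩
    pow (- y * - y) k     ≈⟨ pow-cong k -y*-y≈y*y ⟩
    pow (y * y) k         ≈⟨ pow-2* y k ⟨
    pow y (2 ℕ.* k)       ∎
    where
      -y*-y≈y*y : - y * - y ≈ y * y
      -y*-y≈y*y = trans (sym (-‿distribˡ-* y (- y))) (trans (-‿cong (sym (-‿distribʳ-* y y))) (-‿involutive (y * y)))

  1+y*geom-neg : (y : Carrier) (k : ℕ) → (1# + y) * geom (- y) (2 ℕ.* k) ≈ 1# - pow y (2 ℕ.* k)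
  1+y*geom-neg y k = begin
    a             ≈⟨ +-identityʳ a ⟨
    a + 0#        ≈⟨ +-congˡ (-‿inverseʳ (pow y (2 ℕ.* k))) ⟨
    a + (t - t)   ≈⟨ +-assoc a t (- t) ⟨
    (a + t) - t   ≈⟨ +-congʳ (telescope k) ⟩
    1# - t        ∎
    where
      a = (1# + y) * geom (- y) (2 ℕ.* k)
      t = pow y (2 ℕ.* k)
      telescope : (k : ℕ) → (1# + y) * geom (- y) (2 ℕ.* k) + pow y (2 ℕ.* k) ≈ 1#
      telescope zero    = trans (+-congʳ (zeroʳ _)) (+-identityˡ _)
      telescope (suc k) = begin
          (1# + y) * geom (- y) (2 ℕ.* suc k) + pow y (2 ℕ.* suc k)
        ≡⟨ ≡.cong₂ (λ a b → (1# + y) * geom (- y) a + pow y b) (ℕP.*-suc 2 k) (ℕP.*-suc 2 k) ⟩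
          (1# + y) * ((geom (- y) (2 ℕ.* k) + pow (- y) (2 ℕ.* k)) + - y * pow (- y) (2 ℕ.* k)) + y * (y * u)
        ≈⟨ +-congʳ (*-congˡ (+-cong (+-congˡ (pow-neg-2* y k)) (*-congˡ (pow-neg-2* y k)))) ⟩
          (1# + y) * ((geom (- y) (2 ℕ.* k) + u) + - y * u) + y * (y * u)
        ≈⟨ solve 4 (λ y ny g u → (con 1 :+ y) :* ((g :+ u) :+ ny :* u) :+ y :* (y :* u)
                              := ((con 1 :+ y) :* g :+ u) :+ (u :+ y :* u) :* (y :+ ny)) refl y (- y) (geom (- y) (2 ℕ.* k)) u ⟩
          ((1# + y) * geom (- y) (2 ℕ.* k) + u) + (u + y * u) * (y - y)
        ≈⟨ +-cong (telescope k) (trans (*-congˡ (-‿inverseʳ y)) (zeroʳ _)) ⟩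
          1# + 0#
        ≈⟨ +-identityʳ _ ⟩
          1#
        ∎
        where u = pow y (2 ℕ.* k)

  ∑-words-suc : (k : ℕ) (A : List ℤ) (f : List ℤ → Carrier) →
    ∑ (words (suc k) A) f ≈ ∑ A (λ x → ∑ (words k A) (λ w → f (x ∷ w)))
  ∑-words-suc k A f = trans (∑-concatMap A (λ x → map (x ∷_) (words k A)) f)
    (∑-cong A (λ x → reflexive (∑-map (words k A) (x ∷_) f)))

  ∑-words-∷ʳ : (k : ℕ) (A : List ℤ) (f : List ℤ → Carrier) →
    ∑ (words (suc k) A) f ≈ ∑ (words k A) (λ w → ∑ A (λ a → f (w ∷ʳ a)))
  ∑-words-∷ʳ zero    A f = trans (∑-words-suc zero A f) (trans (∑-cong A (λ x → +-identityʳ _)) (sym (+-identityʳ _)))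
  ∑-words-∷ʳ (suc k) A f = begin
    ∑ (words (suc (suc k)) A) f                                    ≈⟨ ∑-words-suc (suc k) A f ⟩
    ∑ A (λ x → ∑ (words (suc k) A) (λ w → f (x ∷ w)))              ≈⟨ ∑-cong A (λ x → ∑-words-∷ʳ k A (λ w → f (x ∷ w))) ⟩
    ∑ A (λ x → ∑ (words k A) (λ w → ∑ A (λ a → f (x ∷ (w ∷ʳ a)))))   ≈⟨ ∑-words-suc k A (λ w → ∑ A (λ a → f (w ∷ʳ a))) ⟨
    ∑ (words (suc k) A) (λ w → ∑ A (λ a → f (w ∷ʳ a)))             ∎

  ∑-words-cong : (k : ℕ) (A : List ℤ) {f g : List ℤ → Carrier} →
    (∀ w → length w ≡ k → f w ≈ g w) → ∑ (words k A) f ≈ ∑ (words k A) g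
  ∑-words-cong zero    A f≈g = +-congʳ (f≈g [] ≡.refl)
  ∑-words-cong (suc k) A {f} {g} f≈g = begin
    ∑ (words (suc k) A) f                          ≈⟨ ∑-words-suc k A f ⟩
    ∑ A (λ x → ∑ (words k A) (λ w → f (x ∷ w)))   ≈⟨ ∑-cong A (λ x → ∑-words-cong k A (λ w eq → f≈g (x ∷ w) (≡.cong suc eq))) ⟩
    ∑ A (λ x → ∑ (words k A) (λ w → g (x ∷ w)))   ≈⟨ ∑-words-suc k A g ⟨
    ∑ (words (suc k) A) g                          ∎

  ∑-words-every : (k : ℕ) (A : List ℤ) (p : ℤ → Bool) (f : List ℤ → Carrier) →
    ∑ (words k A) (λ w → when (every p w) (f w)) ≈ ∑ (words k (filter (T? ∘ p) A)) f
  ∑-words-every zero    A p f = refl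
  ∑-words-every (suc k) A p f = begin
      ∑ (words (suc k) A) (λ w → when (every p w) (f w))
    ≈⟨ ∑-words-suc k A _ ⟩
      ∑ A (λ x → ∑ (words k A) (λ w → when (p x ∧ every p w) (f (x ∷ w))))
    ≈⟨ ∑-cong A (λ x → trans (∑-cong (words k A) (λ w → reflexive (𝔹.if-∧ (p x)))) (∑-when (p x) (words k A) _)) ⟩
      ∑ A (λ x → when (p x) (∑ (words k A) (λ w → when (every p w) (f (x ∷ w)))))
    ≈⟨ ∑-cong A (λ x → when-cong (p x) (λ _ → ∑-words-every k A p (λ w → f (x ∷ w)))) ⟩
      ∑ A (λ x → when (p x) (∑ (words k A′) (λ w → f (x ∷ w))))
    ≈⟨ ∑-filter (T? ∘ p) A _ ⟨
      ∑ A′ (λ x → ∑ (words k A′) (λ w → f (x ∷ w)))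
    ≈⟨ ∑-words-suc k A′ f ⟨
      ∑ (words (suc k) A′) f
    ∎
    where A′ = filter (T? ∘ p) A

  lastLetterSum : Carrier → ℕ → List ℕ → (ℤ → Carrier) → Carrier
  lastLetterSum x N []      φ = 0#
  lastLetterSum x N (s ∷ S) φ =
    (pow x (N ℕ.+ length S) * φ -[1+ s ] + pow x (length S) * φ (pos (suc s))) + lastLetterSum x N S φ

  lastLetterSum-countAbove : (x : Carrier) (N : ℕ) (T : List ℕ) (φ : ℤ → Carrier) → Sorted T →
    ∑ T (λ i → pow x (N ℕ.+ countAbove i T) * φ -[1+ i ]) + ∑ T (λ i → pow x (countAbove i T) * φ (pos (suc i)))
      ≈ lastLetterSum x N T φ
  lastLetterSum-countAbove x N []      φ []       = +-identityˡ _
  lastLetterSum-countAbove x N (s ∷ S) φ (h ∷ st) = begin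
      (neg s (above s) + ∑ S (λ i → neg i (above i))) + (pos′ s (above s) + ∑ S (λ i → pos′ i (above i)))
    ≈⟨ +-cong (+-cong (reflexive (≡.cong (neg s) (countAbove-head s S h)))
                      (∑-cong-All h (λ {i} s<i → reflexive (≡.cong (neg i) (countAbove-∷-below i s S s<i)))))
              (+-cong (reflexive (≡.cong (pos′ s) (countAbove-head s S h)))
                      (∑-cong-All h (λ {i} s<i → reflexive (≡.cong (pos′ i) (countAbove-∷-below i s S s<i))))) ⟩
      (a + A) + (b + B′)
    ≈⟨ solve 4 (λ a A b B → (a :+ A) :+ (b :+ B) := (a :+ b) :+ (A :+ B)) refl a A b B′ ⟩
      (a + b) + (A + B′)
    ≈⟨ +-congˡ (lastLetterSum-countAbove x N S φ st) ⟩
      lastLetterSum x N (s ∷ S) φ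
    ∎
    where
      above : ℕ → ℕ
      above i = countAbove i (s ∷ S)
      neg pos′ : ℕ → ℕ → Carrier
      neg i k = pow x (N ℕ.+ k) * φ -[1+ i ]
      pos′ i k = pow x k * φ (pos (suc i))
      a = neg s (length S)
      b = pos′ s (length S)
      A = ∑ S (λ i → neg i (countAbove i S))
      B′ = ∑ S (λ i → pos′ i (countAbove i S))

  lastLetterSum-piecewise : (x : Carrier) (N i : ℕ) (S : List ℕ) → Sorted S → All (λ t → (t ≡ᵇ i) ≡ false) S →
    (αn βn αp βp : Carrier) (φ : ℤ → Carrier) →
    (∀ t → φ -[1+ t ] ≈ (if i <ᵇ t then αn else βn)) → (∀ t → φ (pos (suc t)) ≈ (if i <ᵇ t then αp else βp)) →
    lastLetterSum x N S φ
      ≈ (pow x N * αn + αp) * geom x (countAbove i S) + (pow x N * βn + βp) * (pow x (countAbove i S) * geom x (countBelow i S))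
  lastLetterSum-piecewise x N i [] [] [] αn βn αp βp φ φ⁻ φ⁺ =
    sym (trans (+-cong (zeroʳ _) (trans (*-congˡ (zeroʳ _)) (zeroʳ _))) (+-identityʳ _))
  lastLetterSum-piecewise x N i (s ∷ S) (h ∷ st) (s≢i ∷ S≢i) αn βn αp βp φ φ⁻ φ⁺ with <ᵇ-connex s i s≢i
  ... | inj₁ (i<s , s≮i)
    rewrite count-∷ (_<ᵇ i) s S | count-∷ (i <ᵇ_) s S | i<s | s≮i
          | countBelow-none i S (<ᵇ-All-trans i<s h)
          | ≡.sym (countAbove-all i S (<ᵇ-All-trans i<s h)) = begin
      (pow x (N ℕ.+ U) * φ -[1+ s ] + pow x U * φ (pos (suc s))) + lastLetterSum x N S φ
    ≈⟨ +-cong (+-cong (*-cong (pow-+ x N U) (trans (φ⁻ s) (reflexive (𝔹.if-cong i<s))))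
                      (*-congˡ (trans (φ⁺ s) (reflexive (𝔹.if-cong i<s)))))
              IH ⟩
      ((pow x N * pow x U) * αn + pow x U * αp) + ((pow x N * αn + αp) * geom x U + (pow x N * βn + βp) * (pow x U * 0#))
    ≈⟨ solve 8 (λ xN xU an ap bn bp g xx →
                   ((xN :* xU) :* an :+ xU :* ap) :+ ((xN :* an :+ ap) :* g :+ (xN :* bn :+ bp) :* (xU :* con 0))
                := (xN :* an :+ ap) :* (g :+ xU) :+ (xN :* bn :+ bp) :* ((xx :* xU) :* con 0)) refl
         (pow x N) (pow x U) αn αp βn βp (geom x U) x ⟩
      (pow x N * αn + αp) * geom x (suc U) + (pow x N * βn + βp) * (pow x (suc U) * 0#)
    ∎
    where
      U = countAbove i S
      IH = trans (lastLetterSum-piecewise x N i S st S≢i αn βn αp βp φ φ⁻ φ⁺)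
                 (+-congˡ (*-congˡ (*-congˡ (reflexive (≡.cong (geom x) (countBelow-none i S (<ᵇ-All-trans i<s h)))))))
  ... | inj₂ (i≮s , s<i)
    rewrite count-∷ (_<ᵇ i) s S | count-∷ (i <ᵇ_) s S | i≮s | s<i | ≡.sym (countBelow+countAbove i S S≢i) = begin
      (pow x (N ℕ.+ (L ℕ.+ U)) * φ -[1+ s ] + pow x (L ℕ.+ U) * φ (pos (suc s))) + lastLetterSum x N S φ
    ≈⟨ +-cong (+-cong (*-cong (trans (pow-+ x N (L ℕ.+ U)) (*-congˡ (pow-+ x L U))) (trans (φ⁻ s) (reflexive (𝔹.if-cong i≮s))))
                      (*-cong (pow-+ x L U) (trans (φ⁺ s) (reflexive (𝔹.if-cong i≮s)))))
              (lastLetterSum-piecewise x N i S st S≢i αn βn αp βp φ φ⁻ φ⁺) ⟩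
      ((pow x N * (pow x L * pow x U)) * βn + (pow x L * pow x U) * βp)
        + ((pow x N * αn + αp) * geom x U + (pow x N * βn + βp) * (pow x U * geom x L))
    ≈⟨ solve 9 (λ xN xL xU an ap bn bp g h →
                   ((xN :* (xL :* xU)) :* bn :+ (xL :* xU) :* bp) :+ ((xN :* an :+ ap) :* g :+ (xN :* bn :+ bp) :* (xU :* h))
                := (xN :* an :+ ap) :* g :+ (xN :* bn :+ bp) :* (xU :* (h :+ xL))) refl
         (pow x N) (pow x L) (pow x U) αn αp βn βp (geom x U) (geom x L) ⟩
      (pow x N * αn + αp) * geom x U + (pow x N * βn + βp) * (pow x U * geom x (suc L))
    ∎
    where
      U = countAbove i S
      L = countBelow i S

  lastLetterSum-1 : (x : Carrier) (N : ℕ) (S : List ℕ) →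
    lastLetterSum x N S (λ _ → 1#) ≈ geom x (length S) + pow x N * geom x (length S)
  lastLetterSum-1 x N []      = sym (trans (+-identityˡ _) (zeroʳ _))
  lastLetterSum-1 x N (s ∷ S) = begin
      (pow x (N ℕ.+ length S) * 1# + pow x (length S) * 1#) + lastLetterSum x N S (λ _ → 1#)
    ≈⟨ +-cong (+-congʳ (*-congʳ (pow-+ x N (length S)))) (lastLetterSum-1 x N S) ⟩
      ((pow x N * pow x (length S)) * 1# + pow x (length S) * 1#) + (geom x (length S) + pow x N * geom x (length S))
    ≈⟨ solve 3 (λ a b g → ((a :* b) :* con 1 :+ b :* con 1) :+ (g :+ a :* g) := (g :+ b) :+ a :* (g :+ b)) refl
         (pow x N) (pow x (length S)) (geom x (length S)) ⟩
      geom x (suc (length S)) + pow x N * geom x (suc (length S))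
    ∎

  ∏abs : (ℕ → Carrier) → List ℕ → Carrier
  ∏abs ψ T = ∏ T (λ t → ψ (suc t))

  ∏abs-remove : (ψ : ℕ → Carrier) (i : ℕ) (T : List ℕ) → Sorted T → i ∈ T →
    ∏abs ψ T ≈ ψ (suc i) * ∏abs ψ (remove i T)
  ∏abs-remove ψ i (s ∷ S) (h ∷ _)  (here ≡.refl) rewrite remove-head s S h = refl
  ∏abs-remove ψ i (s ∷ S) (h ∷ st) (there i∈S) rewrite <ᵇ⇒≢ᵇ s i (All.lookup h i∈S) =
    trans (*-congˡ (∏abs-remove ψ i S st i∈S)) (x∙yz≈y∙xz (ψ (suc s)) (ψ (suc i)) _)

  geom-2*-+ : (x : Carrier) (L U : ℕ) →
    geom x (2 ℕ.* (L ℕ.+ U)) ≈ (pow x L * pow x U + 1#) * (geom x L + pow x L * geom x U)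
  geom-2*-+ x L U = begin
    geom x (2 ℕ.* (L ℕ.+ U))                         ≈⟨ geom-2* x (L ℕ.+ U) ⟩
    geom x (L ℕ.+ U) + pow x (L ℕ.+ U) * geom x (L ℕ.+ U) ≈⟨ +-cong (geom-+ x L U) (*-cong (pow-+ x L U) (geom-+ x L U)) ⟩
    g + (pow x L * pow x U) * g                       ≈⟨ solve 2 (λ g ab → g :+ ab :* g := (ab :+ con 1) :* g) refl g (pow x L * pow x U) ⟩
    (pow x L * pow x U + 1#) * g                      ∎
    where g = geom x L + pow x L * geom x U

  -- L and U count the letters below and above the removed one, and Q is the descent weight.
  geom-insert-neg : (x Q : Carrier) (L U : ℕ) → Q ≈ pow x (2 ℕ.* (L ℕ.+ U)) →
    (pow x (L ℕ.+ U) * Q + Q) * geom x U + (pow x (L ℕ.+ U) * 1# + Q) * (pow x U * geom x L)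
      ≈ pow x (L ℕ.+ U ℕ.+ U) * geom x (2 ℕ.* (L ℕ.+ U))
  geom-insert-neg x Q L U Q≈ = begin
      (pow x (L ℕ.+ U) * Q + Q) * geom x U + (pow x (L ℕ.+ U) * 1# + Q) * (pow x U * geom x L)
    ≈⟨ +-cong (*-congʳ (+-cong (*-cong ab Q≈ab²) Q≈ab²)) (*-congʳ (+-cong (*-congʳ ab) Q≈ab²)) ⟩
      ((a * b) * ((a * b) * (a * b)) + (a * b) * (a * b)) * h + ((a * b) * 1# + (a * b) * (a * b)) * (b * g)
    ≈⟨ solve 4 (λ a b g h →
                   ((a :* b) :* ((a :* b) :* (a :* b)) :+ (a :* b) :* (a :* b)) :* h :+ ((a :* b) :* con 1 :+ (a :* b) :* (a :* b)) :* (b :* g)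
                := ((a :* b) :* b) :* ((a :* b :+ con 1) :* (g :+ a :* h))) refl a b g h ⟩
      ((a * b) * b) * ((a * b + 1#) * (g + a * h))
    ≈⟨ *-cong (trans (pow-+ x (L ℕ.+ U) U) (*-congʳ ab)) (geom-2*-+ x L U) ⟨
      pow x (L ℕ.+ U ℕ.+ U) * geom x (2 ℕ.* (L ℕ.+ U))
    ∎
    where
      a = pow x L
      b = pow x U
      g = geom x L
      h = geom x U
      ab = pow-+ x L U
      Q≈ab² : Q ≈ (a * b) * (a * b)
      Q≈ab² = trans Q≈ (trans (pow-double x (L ℕ.+ U)) (*-cong ab ab))

  geom-insert-pos : (x Q : Carrier) (L U : ℕ) → Q ≈ pow x (2 ℕ.* (L ℕ.+ U)) →
    (pow x (L ℕ.+ U) * 1# + Q) * geom x U + (pow x (L ℕ.+ U) * 1# + 1#) * (pow x U * geom x L)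
      ≈ pow x U * geom x (2 ℕ.* (L ℕ.+ U))
  geom-insert-pos x Q L U Q≈ = begin
      (pow x (L ℕ.+ U) * 1# + Q) * geom x U + (pow x (L ℕ.+ U) * 1# + 1#) * (pow x U * geom x L)
    ≈⟨ +-cong (*-congʳ (+-cong (*-congʳ ab) Q≈ab²)) (*-congʳ (+-congʳ (*-congʳ ab))) ⟩
      ((a * b) * 1# + (a * b) * (a * b)) * h + ((a * b) * 1# + 1#) * (b * g)
    ≈⟨ solve 4 (λ a b g h →
                   ((a :* b) :* con 1 :+ (a :* b) :* (a :* b)) :* h :+ ((a :* b) :* con 1 :+ con 1) :* (b :* g)
                := b :* ((a :* b :+ con 1) :* (g :+ a :* h))) refl a b g h ⟩
      b * ((a * b + 1#) * (g + a * h))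
    ≈⟨ *-congˡ (geom-2*-+ x L U) ⟨
      pow x U * geom x (2 ℕ.* (L ℕ.+ U))
    ∎
    where
      a = pow x L
      b = pow x U
      g = geom x L
      h = geom x U
      ab = pow-+ x L U
      Q≈ab² : Q ≈ (a * b) * (a * b)
      Q≈ab² = trans Q≈ (trans (pow-double x (L ℕ.+ U)) (*-cong ab ab))

  module Signed (σ : Carrier) (σ²≈1 : σ * σ ≈ 1#) (q : Carrier) where

    pow-σ-2* : (k : ℕ) → pow σ (2 ℕ.* k) ≈ 1#
    pow-σ-2* k = trans (pow-2* σ k) (trans (pow-cong k σ²≈1) (pow-1# k))

    pow-σ-+2* : (a k : ℕ) → pow σ (a ℕ.+ 2 ℕ.* k) ≈ pow σ a
    pow-σ-+2* a k = trans (pow-+ σ a (2 ℕ.* k)) (trans (*-congˡ (pow-σ-2* k)) (*-identityʳ _))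

    sgn : Bool → Carrier
    sgn b = if b then σ else 1#

    pow-σ-bit : (b : Bool) → pow σ (bit b) ≈ sgn b
    pow-σ-bit true  = *-identityʳ σ
    pow-σ-bit false = refl

    pairSign : (a b : ℤ) .⦃ _ : ℤ.NonZero a ⦄ → avoids ∣ a ∣ b ≡ true →
      pow σ (bit (ltℤ a b) ℕ.+ bit (ltℤ (b ℤ.+ a) (pos 0))) ≈ sgn (∣ a ∣ <ᵇ ∣ b ∣)
    pairSign a b ok with pairSign-parity a b (𝔹.not-injective ok)
    ... | e , eq = begin
      pow σ (bit (ltℤ a b) ℕ.+ bit (ltℤ (b ℤ.+ a) (pos 0))) ≡⟨ ≡.cong (pow σ) eq ⟩
      pow σ (bit (∣ a ∣ <ᵇ ∣ b ∣) ℕ.+ 2 ℕ.* e)               ≈⟨ pow-σ-+2* (bit (∣ a ∣ <ᵇ ∣ b ∣)) e ⟩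
      pow σ (bit (∣ a ∣ <ᵇ ∣ b ∣))                          ≈⟨ pow-σ-bit (∣ a ∣ <ᵇ ∣ b ∣) ⟩
      sgn (∣ a ∣ <ᵇ ∣ b ∣)                                  ∎

    pow-σ-count+count : (p p′ : ℤ → Bool) (v : List ℤ) →
      pow σ (count p v ℕ.+ count p′ v) ≈ ∏ v (λ b → pow σ (bit (p b) ℕ.+ bit (p′ b)))
    pow-σ-count+count p p′ []      = refl
    pow-σ-count+count p p′ (b ∷ v) = begin
        pow σ (count p (b ∷ v) ℕ.+ count p′ (b ∷ v))
      ≡⟨ ≡.cong (pow σ) (count+count-∷ p p′ b v) ⟩
        pow σ ((bit (p b) ℕ.+ bit (p′ b)) ℕ.+ (count p v ℕ.+ count p′ v))
      ≈⟨ pow-+ σ (bit (p b) ℕ.+ bit (p′ b)) (count p v ℕ.+ count p′ v) ⟩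
        pow σ (bit (p b) ℕ.+ bit (p′ b)) * pow σ (count p v ℕ.+ count p′ v)
      ≈⟨ *-congˡ (pow-σ-count+count p p′ v) ⟩
        ∏ (b ∷ v) (λ b → pow σ (bit (p b) ℕ.+ bit (p′ b)))
      ∎

    weight : List ℤ → Carrier
    weight u = pow σ (ℓB u) * pow q (fmaj u)

    -- Appending a letter a multiplies the weight by a sign for each earlier letter b, depending
    -- only on whether |b| > |a|, and by a power of q depending on the previous last letter; the
    -- extra weights ψ on absolute values and φ on the last letter absorb exactly these two effects.
    markedWeight : (ℕ → Carrier) → (ℤ → Carrier) → List ℤ → Carrier
    markedWeight ψ φ u = weight u * (∏ u (ψ ∘ ∣_∣) * φ (lastOr (pos 0) u))

    lastLetterWeight : (ℕ → Carrier) → (ℤ → Carrier) → ℤ → Carrier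
    lastLetterWeight ψ φ a = (pow σ (bit (isNeg a)) * pow q (bit (isNeg a))) * (ψ ∣ a ∣ * φ a)

    twistAbove : ℤ → (ℕ → Carrier) → ℕ → Carrier
    twistAbove a ψ n = ψ n * sgn (∣ a ∣ <ᵇ n)

    descentWeight : ℤ → ℕ → ℤ → Carrier
    descentWeight a M b = if precB a b then pow q (2 ℕ.* M) else 1#

    markedWeight-∷ʳ : (ψ : ℕ → Carrier) (φ : ℤ → Carrier) (a : ℤ) .⦃ _ : ℤ.NonZero a ⦄ (y : ℤ) (r : List ℤ) →
      every (avoids ∣ a ∣) (y ∷ r) ≡ true →
      markedWeight ψ φ ((y ∷ r) ∷ʳ a)
        ≈ lastLetterWeight ψ φ a * markedWeight (twistAbove a ψ) (descentWeight a (suc (length r))) (y ∷ r)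
    markedWeight-∷ʳ ψ φ a y r ok = begin
        weight (v ∷ʳ a) * (∏ (v ∷ʳ a) (ψ ∘ ∣_∣) * φ (lastOr y (r ∷ʳ a)))
      ≡⟨ ≡.cong₂ (λ l f → (pow σ l * pow q f) * (∏ (v ∷ʳ a) (ψ ∘ ∣_∣) * φ (lastOr y (r ∷ʳ a)))) (ℓB-∷ʳ v a) (fmaj-∷ʳ y r a) ⟩
        (pow σ (ℓB v ℕ.+ n ℕ.+ k) * pow q (fmaj v ℕ.+ n ℕ.+ 2 ℕ.* d)) * (∏ (v ∷ʳ a) (ψ ∘ ∣_∣) * φ (lastOr y (r ∷ʳ a)))
      ≈⟨ *-cong (*-cong (trans (pow-+ σ (ℓB v ℕ.+ n) k) (*-congʳ (pow-+ σ (ℓB v) n)))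
                        (trans (pow-+ q (fmaj v ℕ.+ n) (2 ℕ.* d)) (*-congʳ (pow-+ q (fmaj v) n))))
                (*-cong (∏-++ v (a ∷ []) (ψ ∘ ∣_∣)) (reflexive (≡.cong φ (lastOr-∷ʳ y r a)))) ⟩
        ((pow σ (ℓB v) * pow σ n * pow σ k) * (pow q (fmaj v) * pow q n * pow q (2 ℕ.* d))) * ((Ψ * (ψ ∣ a ∣ * 1#)) * φ a)
      ≈⟨ *-cong (*-cong (*-congˡ σ^k≈signs) (*-congˡ q^2d≈descent)) (*-congʳ (*-congˡ (*-identityʳ _))) ⟩
        ((pow σ (ℓB v) * pow σ n * signs) * (pow q (fmaj v) * pow q n * D)) * ((Ψ * ψ ∣ a ∣) * φ a)
      ≈⟨ solve 9 (λ sl sn S ql qn D P pa fa → ((sl :* sn :* S) :* (ql :* qn :* D)) :* ((P :* pa) :* fa)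
                                            := ((sn :* qn) :* (pa :* fa)) :* ((sl :* ql) :* ((P :* S) :* D))) refl
           (pow σ (ℓB v)) (pow σ n) signs (pow q (fmaj v)) (pow q n) D Ψ (ψ ∣ a ∣) (φ a) ⟩
        ((pow σ n * pow q n) * (ψ ∣ a ∣ * φ a)) * (weight v * ((Ψ * signs) * D))
      ≈⟨ *-congˡ (*-congˡ (*-congʳ (∏-* v (ψ ∘ ∣_∣) (λ b → sgn (∣ a ∣ <ᵇ ∣ b ∣))))) ⟨
        lastLetterWeight ψ φ a * markedWeight (twistAbove a ψ) (descentWeight a (suc (length r))) v
      ∎
      where
        v = y ∷ r
        n = bit (isNeg a)
        k = count (ltℤ a) v ℕ.+ count (λ b → ltℤ (b ℤ.+ a) (pos 0)) v
        d = if precB a (lastOr y r) then suc (length r) else 0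
        D = descentWeight a (suc (length r)) (lastOr y r)
        Ψ = ∏ v (ψ ∘ ∣_∣)
        signs = ∏ v (λ b → sgn (∣ a ∣ <ᵇ ∣ b ∣))
        σ^k≈signs : pow σ k ≈ signs
        σ^k≈signs = trans (pow-σ-count+count (ltℤ a) (λ b → ltℤ (b ℤ.+ a) (pos 0)) v)
                          (∏-cong-every (avoids ∣ a ∣) v ok (λ b → pairSign a b))
        q^2d≈descent : pow q (2 ℕ.* d) ≈ D
        q^2d≈descent with precB a (lastOr y r)
        ... | true  = refl
        ... | false = refl

    signedSum : List ℕ → ℕ → (ℕ → Carrier) → (ℤ → Carrier) → Carrier
    signedSum T k ψ φ = ∑ (filter distinct? (words k (letters T))) (markedWeight ψ φ)

    sumEndingIn : List ℕ → ℕ → (ℕ → Carrier) → (ℤ → Carrier) → ℤ → Carrier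
    sumEndingIn T k ψ φ a =
      ∑ (words k (letters T)) (λ v → when (does (distinct? (v ∷ʳ a))) (markedWeight ψ φ (v ∷ʳ a)))

    sumEndingIn≈signedSum-remove : (ψ : ℕ → Carrier) (φ : ℤ → Carrier) (a : ℤ) .⦃ _ : ℤ.NonZero a ⦄
      (i : ℕ) → ∣ a ∣ ≡ suc i → (m : ℕ) (T : List ℕ) →
      sumEndingIn T (suc m) ψ φ a
        ≈ lastLetterWeight ψ φ a * signedSum (remove i T) (suc m) (twistAbove a ψ) (descentWeight a (suc m))
    sumEndingIn≈signedSum-remove ψ φ a i ∣a∣≡ m T = begin
        sumEndingIn T (suc m) ψ φ a
      ≈⟨ ∑-words-cong (suc m) A split ⟩
        ∑ (words (suc m) A) (λ v → when (every (avoids ∣ a ∣) v) (K * when (does (distinct? v)) (rest v)))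
      ≈⟨ ∑-words-every (suc m) A (avoids ∣ a ∣) (λ v → K * when (does (distinct? v)) (rest v)) ⟩
        ∑ (words (suc m) (filter (T? ∘ avoids ∣ a ∣) A)) (λ v → K * when (does (distinct? v)) (rest v))
      ≡⟨ ≡.cong (λ B → ∑ (words (suc m) B) (λ v → K * when (does (distinct? v)) (rest v)))
                (≡.trans (≡.cong (λ k → filter (T? ∘ avoids k) A) ∣a∣≡) (filter-letters i T)) ⟩
        ∑ (words (suc m) (letters (remove i T))) (λ v → K * when (does (distinct? v)) (rest v))
      ≈⟨ ∑-*ˡ (words (suc m) (letters (remove i T))) K _ ⟩
        K * ∑ (words (suc m) (letters (remove i T))) (λ v → when (does (distinct? v)) (rest v))
      ≈⟨ *-congˡ (∑-filter distinct? (words (suc m) (letters (remove i T))) rest) ⟨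
        K * signedSum (remove i T) (suc m) (twistAbove a ψ) (descentWeight a (suc m))
      ∎
      where
        A = letters T
        K = lastLetterWeight ψ φ a
        rest = markedWeight (twistAbove a ψ) (descentWeight a (suc m))
        split : ∀ w → length w ≡ suc m →
          when (does (distinct? (w ∷ʳ a))) (markedWeight ψ φ (w ∷ʳ a))
            ≈ when (every (avoids ∣ a ∣) w) (K * when (does (distinct? w)) (rest w))
        split (y ∷ r) ≡.refl = begin
            when (does (distinct? ((y ∷ r) ∷ʳ a))) (markedWeight ψ φ ((y ∷ r) ∷ʳ a))
          ≡⟨ ≡.trans (≡.cong (λ b → when b (markedWeight ψ φ ((y ∷ r) ∷ʳ a))) (distinct-∷ʳ (y ∷ r) a))
                     (𝔹.if-∧ (every (avoids ∣ a ∣) (y ∷ r))) ⟩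
            when (every (avoids ∣ a ∣) (y ∷ r)) (when (does (distinct? (y ∷ r))) (markedWeight ψ φ ((y ∷ r) ∷ʳ a)))
          ≈⟨ when-cong (every (avoids ∣ a ∣) (y ∷ r)) (λ ok →
               trans (when-cong (does (distinct? (y ∷ r))) (λ _ → markedWeight-∷ʳ ψ φ a y r ok))
                     (when-*ʳ (does (distinct? (y ∷ r))) K (rest (y ∷ r)))) ⟩
            when (every (avoids ∣ a ∣) (y ∷ r)) (K * when (does (distinct? (y ∷ r))) (rest (y ∷ r)))
          ∎

    twist : ℕ → Carrier
    twist k = pow σ k * q

    factor : ℕ → Carrier
    factor zero    = 1#
    factor (suc m) = factor m * geom (twist (suc m)) (2 ℕ.* suc m)

    pow-twist : (k n : ℕ) → pow (twist k) n ≈ pow σ (k ℕ.* n) * pow q n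
    pow-twist k n = trans (pow-*ˡ (pow σ k) q n) (*-congʳ (pow-pow σ k n))

    pow-q≈pow-twist : (M : ℕ) → pow q (2 ℕ.* M) ≈ pow (twist M) (2 ℕ.* M)
    pow-q≈pow-twist M = sym (begin
      pow (twist M) (2 ℕ.* M)                 ≈⟨ pow-twist M (2 ℕ.* M) ⟩
      pow σ (M ℕ.* (2 ℕ.* M)) * pow q (2 ℕ.* M) ≡⟨ ≡.cong (λ k → pow σ k * pow q (2 ℕ.* M)) (ℕP.*-comm M (2 ℕ.* M)) ⟩
      pow σ (2 ℕ.* M ℕ.* M) * pow q (2 ℕ.* M)   ≡⟨ ≡.cong (λ k → pow σ k * pow q (2 ℕ.* M)) (ℕP.*-assoc 2 M M) ⟩
      pow σ (2 ℕ.* (M ℕ.* M)) * pow q (2 ℕ.* M) ≈⟨ *-congʳ (pow-σ-2* (M ℕ.* M)) ⟩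
      1# * pow q (2 ℕ.* M)                     ≈⟨ *-identityˡ _ ⟩
      pow q (2 ℕ.* M)                          ∎)

    pow-twist-suc : (M U : ℕ) → pow σ U * pow (twist M) U ≈ pow (twist (suc M)) U
    pow-twist-suc M U = begin
      pow σ U * pow (twist M) U                 ≈⟨ *-congˡ (pow-twist M U) ⟩
      pow σ U * (pow σ (M ℕ.* U) * pow q U)     ≈⟨ *-assoc _ _ _ ⟨
      (pow σ U * pow σ (M ℕ.* U)) * pow q U     ≈⟨ *-congʳ (pow-+ σ U (M ℕ.* U)) ⟨
      pow σ (suc M ℕ.* U) * pow q U             ≈⟨ pow-twist (suc M) U ⟨
      pow (twist (suc M)) U                     ∎

    pow-twist-suc-neg : (M U : ℕ) →
      (pow σ 1 * pow q 1) * (pow σ U * pow (twist M) (M ℕ.+ U)) ≈ pow (twist (suc M)) (suc M ℕ.+ U)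
    pow-twist-suc-neg M U = begin
        (pow σ 1 * pow q 1) * (pow σ U * pow (twist M) (M ℕ.+ U))
      ≈⟨ *-congˡ (*-congˡ (pow-twist M (M ℕ.+ U))) ⟩
        (pow σ 1 * pow q 1) * (pow σ U * (pow σ (M ℕ.* (M ℕ.+ U)) * pow q (M ℕ.+ U)))
      ≈⟨ solve 5 (λ s₁ q₁ sU sM qM → (s₁ :* q₁) :* (sU :* (sM :* qM)) := (s₁ :* (sU :* sM)) :* (q₁ :* qM)) refl
           (pow σ 1) (pow q 1) (pow σ U) (pow σ (M ℕ.* (M ℕ.+ U))) (pow q (M ℕ.+ U)) ⟩
        (pow σ 1 * (pow σ U * pow σ (M ℕ.* (M ℕ.+ U)))) * (pow q 1 * pow q (M ℕ.+ U))
      ≈⟨ *-cong (trans (pow-+ σ 1 (U ℕ.+ M ℕ.* (M ℕ.+ U))) (*-congˡ (pow-+ σ U (M ℕ.* (M ℕ.+ U)))))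
                (pow-+ q 1 (M ℕ.+ U)) ⟨
        pow σ (1 ℕ.+ (U ℕ.+ M ℕ.* (M ℕ.+ U))) * pow q (suc M ℕ.+ U)
      ≈⟨ *-congʳ (pow-σ-+2* (1 ℕ.+ (U ℕ.+ M ℕ.* (M ℕ.+ U))) M) ⟨
        pow σ (1 ℕ.+ (U ℕ.+ M ℕ.* (M ℕ.+ U)) ℕ.+ 2 ℕ.* M) * pow q (suc M ℕ.+ U)
      ≡⟨ ≡.cong (λ k → pow σ k * pow q (suc M ℕ.+ U)) exponent ⟩
        pow σ (suc M ℕ.* (suc M ℕ.+ U)) * pow q (suc M ℕ.+ U)
      ≈⟨ pow-twist (suc M) (suc M ℕ.+ U) ⟨
        pow (twist (suc M)) (suc M ℕ.+ U)
      ∎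
      where
        open +-*-Solver using () renaming (solve to solveℕ; _:+_ to _⊕_; _:*_ to _⊗_; _:=_ to _≐_; con to κ)
        exponent : 1 ℕ.+ (U ℕ.+ M ℕ.* (M ℕ.+ U)) ℕ.+ 2 ℕ.* M ≡ suc M ℕ.* (suc M ℕ.+ U)
        exponent = solveℕ 2 (λ m u → κ 1 ⊕ (u ⊕ m ⊗ (m ⊕ u)) ⊕ κ 2 ⊗ m ≐ (κ 1 ⊕ m) ⊗ ((κ 1 ⊕ m) ⊕ u)) ≡.refl M U

    ∏abs-twistAbove : (ψ : ℕ → Carrier) (i : ℕ) (S : List ℕ) →
      ∏abs (λ k → ψ k * sgn (suc i <ᵇ k)) S ≈ ∏abs ψ S * pow σ (countAbove i S)
    ∏abs-twistAbove ψ i []      = sym (*-identityˡ _)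
    ∏abs-twistAbove ψ i (s ∷ S) = begin
        (ψ (suc s) * sgn (i <ᵇ s)) * ∏abs (λ k → ψ k * sgn (suc i <ᵇ k)) S
      ≈⟨ *-congˡ (∏abs-twistAbove ψ i S) ⟩
        (ψ (suc s) * sgn (i <ᵇ s)) * (∏abs ψ S * pow σ (countAbove i S))
      ≈⟨ solve 4 (λ a b c d → (a :* b) :* (c :* d) := (a :* c) :* (b :* d)) refl
           (ψ (suc s)) (sgn (i <ᵇ s)) (∏abs ψ S) (pow σ (countAbove i S)) ⟩
        (ψ (suc s) * ∏abs ψ S) * (sgn (i <ᵇ s) * pow σ (countAbove i S))
      ≈⟨ *-congˡ (trans (*-congʳ (sym (pow-σ-bit (i <ᵇ s)))) (sym (pow-+ σ (bit (i <ᵇ s)) (countAbove i S)))) ⟩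
        (ψ (suc s) * ∏abs ψ S) * pow σ (bit (i <ᵇ s) ℕ.+ countAbove i S)
      ≡⟨ ≡.cong (λ k → (ψ (suc s) * ∏abs ψ S) * pow σ k) (≡.sym (count-∷ (i <ᵇ_) s S)) ⟩
        ∏abs ψ (s ∷ S) * pow σ (countAbove i (s ∷ S))
      ∎

    lastLetterSum-descent-neg : (M i : ℕ) (T : List ℕ) → Sorted T → All (λ t → (t ≡ᵇ i) ≡ false) T → length T ≡ M →
      lastLetterSum (twist M) M T (descentWeight -[1+ i ] M)
        ≈ pow (twist M) (M ℕ.+ countAbove i T) * geom (twist M) (2 ℕ.* M)
    lastLetterSum-descent-neg M i T st T≢i lenT with ≡.trans (countBelow+countAbove i T T≢i) lenT
    ... | ≡.refl = trans
      (lastLetterSum-piecewise (twist M) M i T st T≢i Q 1# Q Q _ (λ _ → refl) (λ t → reflexive (≡.sym (𝔹.if-eta (i <ᵇ t)))))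
      (geom-insert-neg (twist M) Q (countBelow i T) (countAbove i T) (pow-q≈pow-twist M))
      where Q = pow q (2 ℕ.* M)

    lastLetterSum-descent-pos : (M i : ℕ) (T : List ℕ) → Sorted T → All (λ t → (t ≡ᵇ i) ≡ false) T → length T ≡ M →
      lastLetterSum (twist M) M T (descentWeight (pos (suc i)) M)
        ≈ pow (twist M) (countAbove i T) * geom (twist M) (2 ℕ.* M)
    lastLetterSum-descent-pos M i T st T≢i lenT with ≡.trans (countBelow+countAbove i T T≢i) lenT
    ... | ≡.refl = trans
      (lastLetterSum-piecewise (twist M) M i T st T≢i 1# 1# Q 1# _ (λ t → reflexive (≡.sym (𝔹.if-eta (i <ᵇ t)))) (λ _ → refl))
      (geom-insert-pos (twist M) Q (countBelow i T) (countAbove i T) (pow-q≈pow-twist M))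
      where Q = pow q (2 ℕ.* M)

    Factorises : ℕ → Set (c ⊔ ℓ)
    Factorises m = (T : List ℕ) → Sorted T → length T ≡ suc m → (ψ : ℕ → Carrier) (φ : ℤ → Carrier) →
      signedSum T (suc m) ψ φ ≈ factor m * (∏abs ψ T * lastLetterSum (twist (suc m)) (suc m) T φ)

    signedSum-by-last : (T : List ℕ) (k : ℕ) (ψ : ℕ → Carrier) (φ : ℤ → Carrier) →
      signedSum T (suc k) ψ φ ≈ ∑ T (λ i → sumEndingIn T k ψ φ -[1+ i ]) + ∑ T (λ i → sumEndingIn T k ψ φ (pos (suc i)))
    signedSum-by-last T k ψ φ = begin
        signedSum T (suc k) ψ φ
      ≈⟨ ∑-filter distinct? (words (suc k) A) (markedWeight ψ φ) ⟩
        ∑ (words (suc k) A) (λ u → when (does (distinct? u)) (markedWeight ψ φ u))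
      ≈⟨ ∑-words-∷ʳ k A (λ u → when (does (distinct? u)) (markedWeight ψ φ u)) ⟩
        ∑ (words k A) (λ v → ∑ A (λ a → ending a v))
      ≈⟨ ∑-comm (words k A) A (λ v a → ending a v) ⟩
        ∑ A (sumEndingIn T k ψ φ)
      ≈⟨ ∑-++ (map -[1+_] T) (map (pos ∘ suc) T) (sumEndingIn T k ψ φ) ⟩
        ∑ (map -[1+_] T) (sumEndingIn T k ψ φ) + ∑ (map (pos ∘ suc) T) (sumEndingIn T k ψ φ)
      ≡⟨ ≡.cong₂ _+_ (∑-map T -[1+_] (sumEndingIn T k ψ φ)) (∑-map T (pos ∘ suc) (sumEndingIn T k ψ φ)) ⟩
        ∑ T (λ i → sumEndingIn T k ψ φ -[1+ i ]) + ∑ T (λ i → sumEndingIn T k ψ φ (pos (suc i)))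
      ∎
      where
        A = letters T
        ending : ℤ → List ℤ → Carrier
        ending a v = when (does (distinct? (v ∷ʳ a))) (markedWeight ψ φ (v ∷ʳ a))

    sumEndingIn-neg : (m : ℕ) → Factorises m → (T : List ℕ) → Sorted T → length T ≡ suc (suc m) →
      (ψ : ℕ → Carrier) (φ : ℤ → Carrier) (i : ℕ) → i ∈ T →
      sumEndingIn T (suc m) ψ φ -[1+ i ]
        ≈ (factor (suc m) * ∏abs ψ T) * (pow (twist (suc (suc m))) (suc (suc m) ℕ.+ countAbove i T) * φ -[1+ i ])
    sumEndingIn-neg m IH T st lenT ψ φ i i∈T = begin
        sumEndingIn T M ψ φ a
      ≈⟨ sumEndingIn≈signedSum-remove ψ φ a i ≡.refl m T ⟩
        K * signedSum T′ M (twistAbove a ψ) (descentWeight a M)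
      ≈⟨ *-congˡ (IH T′ (remove-sorted i T st) lenT′ (twistAbove a ψ) (descentWeight a M)) ⟩
        K * (factor m * (∏abs (twistAbove a ψ) T′ * lastLetterSum x M T′ (descentWeight a M)))
      ≈⟨ *-congˡ (*-congˡ (*-cong (∏abs-twistAbove ψ i T′)
                                  (lastLetterSum-descent-neg M i T′ (remove-sorted i T st) (remove-excludes i T) lenT′))) ⟩
        ((pow σ 1 * pow q 1) * (ψ (suc i) * φ a)) * (factor m * ((∏abs ψ T′ * pow σ U) * (pow x (M ℕ.+ U) * geom x (2 ℕ.* M))))
      ≈⟨ solve 9 (λ s₁ q₁ ψi φa F P σU xU g → ((s₁ :* q₁) :* (ψi :* φa)) :* (F :* ((P :* σU) :* (xU :* g)))
                                             := (F :* g) :* (ψi :* P) :* (((s₁ :* q₁) :* (σU :* xU)) :* φa)) refl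
           (pow σ 1) (pow q 1) (ψ (suc i)) (φ a) (factor m) (∏abs ψ T′) (pow σ U) (pow x (M ℕ.+ U)) (geom x (2 ℕ.* M)) ⟩
        (factor M * (ψ (suc i) * ∏abs ψ T′)) * (((pow σ 1 * pow q 1) * (pow σ U * pow x (M ℕ.+ U))) * φ a)
      ≈⟨ *-cong (*-congˡ (sym (∏abs-remove ψ i T st i∈T))) (*-congʳ (pow-twist-suc-neg M U)) ⟩
        (factor M * ∏abs ψ T) * (pow (twist (suc M)) (suc M ℕ.+ U) * φ a)
      ≡⟨ ≡.cong (λ k → (factor M * ∏abs ψ T) * (pow (twist (suc M)) (suc M ℕ.+ k) * φ a)) (countAbove-remove i T) ⟩
        (factor M * ∏abs ψ T) * (pow (twist (suc M)) (suc M ℕ.+ countAbove i T) * φ a)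
      ∎
      where
        M = suc m
        a = -[1+ i ]
        x = twist M
        T′ = remove i T
        U = countAbove i T′
        K = lastLetterWeight ψ φ a
        lenT′ : length T′ ≡ M
        lenT′ = ℕP.suc-injective (≡.trans (≡.sym (length-remove i T st i∈T)) lenT)

    sumEndingIn-pos : (m : ℕ) → Factorises m → (T : List ℕ) → Sorted T → length T ≡ suc (suc m) →
      (ψ : ℕ → Carrier) (φ : ℤ → Carrier) (i : ℕ) → i ∈ T →
      sumEndingIn T (suc m) ψ φ (pos (suc i))
        ≈ (factor (suc m) * ∏abs ψ T) * (pow (twist (suc (suc m))) (countAbove i T) * φ (pos (suc i)))
    sumEndingIn-pos m IH T st lenT ψ φ i i∈T = begin
        sumEndingIn T M ψ φ a
      ≈⟨ sumEndingIn≈signedSum-remove ψ φ a i ≡.refl m T ⟩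
        K * signedSum T′ M (twistAbove a ψ) (descentWeight a M)
      ≈⟨ *-congˡ (IH T′ (remove-sorted i T st) lenT′ (twistAbove a ψ) (descentWeight a M)) ⟩
        K * (factor m * (∏abs (twistAbove a ψ) T′ * lastLetterSum x M T′ (descentWeight a M)))
      ≈⟨ *-congˡ (*-congˡ (*-cong (∏abs-twistAbove ψ i T′)
                                  (lastLetterSum-descent-pos M i T′ (remove-sorted i T st) (remove-excludes i T) lenT′))) ⟩
        ((1# * 1#) * (ψ (suc i) * φ a)) * (factor m * ((∏abs ψ T′ * pow σ U) * (pow x U * geom x (2 ℕ.* M))))
      ≈⟨ solve 7 (λ ψi φa F P σU xU g → ((con 1 :* con 1) :* (ψi :* φa)) :* (F :* ((P :* σU) :* (xU :* g)))
                                       := (F :* g) :* (ψi :* P) :* ((σU :* xU) :* φa)) refl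
           (ψ (suc i)) (φ a) (factor m) (∏abs ψ T′) (pow σ U) (pow x U) (geom x (2 ℕ.* M)) ⟩
        (factor M * (ψ (suc i) * ∏abs ψ T′)) * ((pow σ U * pow x U) * φ a)
      ≈⟨ *-cong (*-congˡ (sym (∏abs-remove ψ i T st i∈T))) (*-congʳ (pow-twist-suc M U)) ⟩
        (factor M * ∏abs ψ T) * (pow (twist (suc M)) U * φ a)
      ≡⟨ ≡.cong (λ k → (factor M * ∏abs ψ T) * (pow (twist (suc M)) k * φ a)) (countAbove-remove i T) ⟩
        (factor M * ∏abs ψ T) * (pow (twist (suc M)) (countAbove i T) * φ a)
      ∎
      where
        M = suc m
        a = pos (suc i)
        x = twist M
        T′ = remove i T
        U = countAbove i T′
        K = lastLetterWeight ψ φ a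
        lenT′ : length T′ ≡ M
        lenT′ = ℕP.suc-injective (≡.trans (≡.sym (length-remove i T st i∈T)) lenT)

    factorises-zero : Factorises 0
    factorises-zero (i ∷ []) _ _ ψ φ =
      solve 5 (λ s q ψi fn fp →
                  ((s :* con 1) :* (q :* con 1)) :* ((ψi :* con 1) :* fn) :+ ((con 1 :* con 1) :* ((ψi :* con 1) :* fp) :+ con 0)
               := con 1 :* ((ψi :* con 1) :* ((((s :* con 1) :* q) :* con 1) :* fn :+ con 1 :* fp :+ con 0)))
        refl σ q (ψ (suc i)) (φ -[1+ i ]) (φ (pos (suc i)))

    factorises-suc : (m : ℕ) → Factorises m → Factorises (suc m)
    factorises-suc m IH T st lenT ψ φ = begin
        signedSum T (suc M) ψ φ
      ≈⟨ signedSum-by-last T M ψ φ ⟩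
        ∑ T (λ i → sumEndingIn T M ψ φ -[1+ i ]) + ∑ T (λ i → sumEndingIn T M ψ φ (pos (suc i)))
      ≈⟨ +-cong (∑-cong-All T∈T (sumEndingIn-neg m IH T st lenT ψ φ _))
                (∑-cong-All T∈T (sumEndingIn-pos m IH T st lenT ψ φ _)) ⟩
        ∑ T (λ i → K * (pow x (suc M ℕ.+ countAbove i T) * φ -[1+ i ])) + ∑ T (λ i → K * (pow x (countAbove i T) * φ (pos (suc i))))
      ≈⟨ trans (+-cong (∑-*ˡ T K _) (∑-*ˡ T K _)) (sym (distribˡ K _ _)) ⟩
        K * (∑ T (λ i → pow x (suc M ℕ.+ countAbove i T) * φ -[1+ i ]) + ∑ T (λ i → pow x (countAbove i T) * φ (pos (suc i))))
      ≈⟨ *-congˡ (lastLetterSum-countAbove x (suc M) T φ st) ⟩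
        K * lastLetterSum x (suc M) T φ
      ≈⟨ *-assoc _ _ _ ⟩
        factor M * (∏abs ψ T * lastLetterSum x (suc M) T φ)
      ∎
      where
        M = suc m
        x = twist (suc M)
        K = factor M * ∏abs ψ T
        T∈T : All (_∈ T) T
        T∈T = All.tabulate id

    factorises : (m : ℕ) → Factorises m
    factorises zero    = factorises-zero
    factorises (suc m) = factorises-suc m (factorises m)

    ∑-weight-B : (m : ℕ) → ∑ (B m) weight ≈ factor m
    ∑-weight-B zero    = trans (+-identityʳ _) (*-identityʳ 1#)
    ∑-weight-B (suc m) = begin
        ∑ (B k) weight
      -- B k unfolds to filter distinct? (words k (letters (upTo k))).
      ≈⟨ ∑-cong (B k) (λ u → sym (trans (*-congˡ (trans (*-identityʳ _) (∏-1 u))) (*-identityʳ _))) ⟩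
        signedSum (upTo k) k one one
      ≈⟨ factorises m (upTo k) (upTo-sorted k) (List.length-upTo k) one one ⟩
        factor m * (∏abs one (upTo k) * lastLetterSum (twist k) k (upTo k) one)
      ≈⟨ *-congˡ (*-cong (∏-1 (upTo k)) (lastLetterSum-1 (twist k) k (upTo k))) ⟩
        factor m * (1# * (geom (twist k) (length (upTo k)) + pow (twist k) k * geom (twist k) (length (upTo k))))
      ≡⟨ ≡.cong (λ n → factor m * (1# * (geom (twist k) n + pow (twist k) k * geom (twist k) n))) (List.length-upTo k) ⟩
        factor m * (1# * (geom (twist k) k + pow (twist k) k * geom (twist k) k))
      ≈⟨ *-congˡ (trans (*-identityˡ _) (sym (geom-2* (twist k) k))) ⟩
        factor k
      ∎
      where
        k = suc m
        one : {A : Set} → A → Carrier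
        one _ = 1#

  -1²≈1 : - 1# * - 1# ≈ 1#
  -1²≈1 = trans (-1*x≈-x (- 1#)) (-‿involutive 1#)

  module Alternating (q : Carrier) where
    module Neg = Signed (- 1#) -1²≈1 q
    module Pos = Signed 1# (*-identityʳ 1#) (q * q)

    oddFactor : ℕ → Carrier
    oddFactor n = ∏ (upTo n) (λ j → 1# - pow q (4 ℕ.* suc j ℕ.∸ 2))

    factor-2* : (n : ℕ) → Neg.factor (2 ℕ.* n) ≈ oddFactor n * Pos.factor n
    factor-2* zero    = sym (*-identityˡ _)
    factor-2* (suc n) = begin
        Neg.factor e
      ≡⟨ unfold-twice ⟩
        (Neg.factor (2 ℕ.* n) * geom (Neg.twist o) (2 ℕ.* o)) * geom (Neg.twist e) (2 ℕ.* e)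
      ≈⟨ *-cong (*-cong (factor-2* n) (geom-cong (2 ℕ.* o) twist-odd))
                (trans (geom-cong (2 ℕ.* e) twist-even) (geom-2*-split q e)) ⟩
        ((oddFactor n * Pos.factor n) * geom (- q) (2 ℕ.* o)) * ((1# + q) * geom (q * q) e)
      ≈⟨ solve 5 (λ h f g w g′ → ((h :* f) :* g) :* (w :* g′) := (h :* (w :* g)) :* (f :* g′)) refl
           (oddFactor n) (Pos.factor n) (geom (- q) (2 ℕ.* o)) (1# + q) (geom (q * q) e) ⟩
        (oddFactor n * ((1# + q) * geom (- q) (2 ℕ.* o))) * (Pos.factor n * geom (q * q) e)
      ≈⟨ *-cong (*-congˡ (1+y*geom-neg q o)) (*-congˡ (geom-cong e (sym twist-pos))) ⟩
        (oddFactor n * (1# - pow q (2 ℕ.* o))) * Pos.factor (suc n)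
      ≡⟨ ≡.cong (λ k → (oddFactor n * (1# - pow q k)) * Pos.factor (suc n)) (≡.sym 4*suc∸2) ⟩
        (oddFactor n * (1# - pow q (4 ℕ.* suc n ℕ.∸ 2))) * Pos.factor (suc n)
      ≈⟨ *-congʳ (∏-upTo-suc n (λ j → 1# - pow q (4 ℕ.* suc j ℕ.∸ 2))) ⟨
        oddFactor (suc n) * Pos.factor (suc n)
      ∎
      where
        o = suc (2 ℕ.* n)
        e = 2 ℕ.* suc n
        unfold-twice : Neg.factor e ≡ (Neg.factor (2 ℕ.* n) * geom (Neg.twist o) (2 ℕ.* o)) * geom (Neg.twist e) (2 ℕ.* e)
        unfold-twice = unfold e (ℕP.*-suc 2 n)
          where
            unfold : (k : ℕ) → k ≡ suc o →
              Neg.factor k ≡ (Neg.factor (2 ℕ.* n) * geom (Neg.twist o) (2 ℕ.* o)) * geom (Neg.twist k) (2 ℕ.* k)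
            unfold _ ≡.refl = ≡.refl
        twist-odd : Neg.twist o ≈ - q
        twist-odd = trans (*-congʳ (trans (*-congˡ (Neg.pow-σ-2* n)) (*-identityʳ _))) (-1*x≈-x q)
        twist-even : Neg.twist e ≈ q
        twist-even = trans (*-congʳ (Neg.pow-σ-2* (suc n))) (*-identityˡ q)
        twist-pos : Pos.twist (suc n) ≈ q * q
        twist-pos = trans (*-congʳ (pow-1# (suc n))) (*-identityˡ _)
        4*suc∸2 : 4 ℕ.* suc n ℕ.∸ 2 ≡ 2 ℕ.* o
        4*suc∸2 = ≡.trans (≡.cong (ℕ._∸ 2) (ℕP.*-suc 4 n))
                    (≡.trans (≡.cong (2 ℕ.+_) (ℕP.*-assoc 2 2 n)) (≡.sym (ℕP.*-suc 2 (2 ℕ.* n))))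

    lhs≈rhs : (n : ℕ) → lhs n q ≈ rhs n q
    lhs≈rhs n = begin
      lhs n q                            ≈⟨ Neg.∑-weight-B (2 ℕ.* n) ⟩
      Neg.factor (2 ℕ.* n)               ≈⟨ factor-2* n ⟩
      oddFactor n * Pos.factor n          ≈⟨ *-congˡ (Pos.∑-weight-B n) ⟨
      oddFactor n * ∑ (B n) Pos.weight    ≈⟨ *-congˡ (∑-cong (B n) weight≈) ⟩
      rhs n q                            ∎
      where
        weight≈ : (β : List ℤ) → Pos.weight β ≈ pow q (2 ℕ.* fmaj β)
        weight≈ β = trans (*-congʳ (pow-1# (ℓB β))) (trans (*-identityˡ _) (sym (pow-2* q (fmaj β))))

-- The identity holds for n = 0 as well.
theorem3p2 : {c ℓ : Level} (R : CommutativeRing c ℓ) (n : ℕ) → 0 < n →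
    (q : CommutativeRing.Carrier R) →
    CommutativeRing._≈_ R (RingOps.lhs R n q) (RingOps.rhs R n q)
theorem3p2 R n _ q = Alternating.lhs≈rhs R q n
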